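{- Let $G_1,G_2$ be unidirectional, edge-labeled Eulerian graphs with modified alignment graph $(V\cup\{s,t\},E)$, and consider the integer program (lower bound ILP) $\min_{x\in\mathbb{N}^{E}}\sum_{e\in E}x_e\delta(e)$ subject to: for $i=1,2$ and every $f\in E_i$, $\sum_{e\in E\text{ not incident to }s,t}x_eI_i(e,f)=1$; $\sum_{(s,u)\in E}x_{su}=1$; $\sum_{(v,t)\in E}x_{vt}=1$; and for every $v\in V$, $\sum_{(u,v)\in E}x_{uv}=\sum_{(v,w)\in E}x_{vw}$. Let $c^{opt}$ be its optimal value. Then there exists an optimal solution $x^{opt}$ such that the subgraph of the modified alignment graph formed by the edges $e$ with $x^{opt}_e\ge 1$ has exactly one connected component if and only if $c^{opt}=\mathrm{GTED}(G_1,G_2)$.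
   Context: A unidirectional, edge-labeled Eulerian graph is a connected directed multigraph $G=(V,E,\ell,\Sigma)$ with edge labels $\ell:E\to\Sigma$, having an Eulerian trail (traversing every edge exactly once; open or closed), with all edges between the same pair of vertices pointing in the same direction. $\mathrm{str}(t)$ is the concatenation of labels along trail $t$; $\mathrm{GTED}(G_1,G_2)=\min\{\mathrm{edit}(\mathrm{str}(t_1),\mathrm{str}(t_2)):t_i\text{ Eulerian trail of }G_i\}$ with unit-cost Levenshtein distance. For $G_i=(V_i,E_i,\ell_i,\Sigma)$, the alignment graph has vertex set $V=V_1\times V_2$ and edges: vertical $[(u_1,u_2),(v_1,u_2)]$ for $(u_1,v_1)\in E_1,u_2\in V_2$ (projects to $(u_1,v_1)\in E_1$, cost 1); horizontal $[(u_1,u_2),(u_1,v_2)]$ for $u_1\in V_1,(u_2,v_2)\in E_2$ (projects to $(u_2,v_2)\in E_2$, cost 1); diagonal $[(u_1,u_2),(v_1,v_2)]$ for $(u_1,v_1)\in E_1,(u_2,v_2)\in E_2$ (projects to both; cost 0 if the labels agree, 1 otherwise). $I_i(e,f)=1$ if $e$ projects to $f\in E_i$, else 0. The modified alignment graph adds source $s$ and sink $t$ with edges of cost 0: (a) if exactly one input graph, say $G_1$, has only open Eulerian trails, from $a_1$ to $b_1$, add $[s,(a_1,v_2)]$ and $[(b_1,v_2),t]$ for all $v_2\in V_2$; (b) if both have closed Eulerian trails, with arbitrary $a_1\in V_1,a_2\in V_2$, add $[s,(a_1,v_2)],[s,(v_1,a_2)],[(a_1,v_2),t],[(v_1,a_2),t]$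 for all $v_1,v_2$; (c) if both have open Eulerian trails from $a_i$ to $b_i$, add $[s,(a_1,a_2)]$ and $[(b_1,b_2),t]$. Connected components are taken in the undirected sense. -}

module Defs where

open import Data.Nat using (ℕ; zero; suc; _+_; _*_; _≤_; _⊔_; _⊓_)
open import Data.Fin using (Fin; zero; suc) renaming (_≟_ to _≟F_)
open import Data.Bool using (Bool; true; false; if_then_else_; _∧_; _∨_)
open import Data.List using (List; []; _∷_; length; map)
open import Data.List using () renaming (allFin to allFinL)
open import Data.List.Relation.Binary.Permutation.Propositional using (_↭_)
open import Data.Product using (Σ; ∃; _×_; _,_)
open import Data.Sum using (_⊎_)
open import Relation.Nullary using (¬_)
open import Relation.Nullary.Decidable using (⌊_⌋)
open import Relation.Binary.Definitions using (DecidableEquality)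
open import Relation.Binary.PropositionalEquality using (_≡_)
open import Relation.Binary.Construct.Closure.ReflexiveTransitive using (Star)

sumF : (n : ℕ) → (Fin n → ℕ) → ℕ
sumF zero    f = 0
sumF (suc n) f = f zero + sumF n (λ i → f (suc i))

record Graph (A : Set) : Set where
  field
    nV  : ℕ
    nE  : ℕ
    src : Fin nE → Fin nV
    tgt : Fin nE → Fin nV
    lab : Fin nE → A

module _ {A : Set} (G : Graph A) where
  open Graph G

  UAdj : Fin nV → Fin nV → Set
  UAdj u v = ∃ λ e → (src e ≡ u × tgt e ≡ v) ⊎ (src e ≡ v × tgt e ≡ u)

  Connected : Set
  Connected = ∀ u v → Star UAdj u v

  -- all edges between the same pair of vertices point in the same direction
  Unidirectional : Set
  Unidirectional = ∀ e f → src e ≡ tgt f → tgt e ≡ src f → src e ≡ tgt e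

  WalkFromTo : Fin nV → List (Fin nE) → Fin nV → Set
  WalkFromTo a []       b = a ≡ b
  WalkFromTo a (e ∷ es) b = src e ≡ a × WalkFromTo (tgt e) es b

  EulerTrailFromTo : Fin nV → List (Fin nE) → Fin nV → Set
  EulerTrailFromTo a t b = WalkFromTo a t b × (t ↭ allFinL nE)

  EulerTrail : List (Fin nE) → Set
  EulerTrail t = ∃ λ a → ∃ λ b → EulerTrailFromTo a t b

  HasEulerTrail : Set
  HasEulerTrail = ∃ EulerTrail

  str : List (Fin nE) → List A
  str = map lab

  UEGraph : Set
  UEGraph = Connected × Unidirectional × HasEulerTrail

  -- The choice of "ends" used to build the modified alignment graph:
  --  * closedE a : the graph has a closed Eulerian trail; a is an arbitrary vertex
  --  * openE a b : the graph has (only) open Eulerian trails, from a to b (a ≠ b)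
  data Ends : Set where
    closedE : (a : Fin nV) → (∃ λ c → ∃ λ t → EulerTrailFromTo c t c) → Ends
    openE   : (a b : Fin nV) → ¬ (a ≡ b) → (∃ λ t → EulerTrailFromTo a t b) → Ends

module _ {A : Set} (_≟A_ : DecidableEquality A) where

  mismatch : A → A → ℕ
  mismatch x y = if ⌊ x ≟A y ⌋ then 0 else 1

  edit : List A → List A → ℕ
  edit []       ys       = length ys
  edit (x ∷ xs) []       = length (x ∷ xs)
  edit (x ∷ xs) (y ∷ ys) =
    suc (edit xs (y ∷ ys)) ⊓ (suc (edit (x ∷ xs) ys) ⊓ (mismatch x y + edit xs ys))

  IsGTED : (G₁ G₂ : Graph A) → ℕ → Set
  IsGTED G₁ G₂ d =
    (∃ λ t₁ → ∃ λ t₂ → EulerTrail G₁ t₁ × EulerTrail G₂ t₂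
        × edit (str G₁ t₁) (str G₂ t₂) ≡ d)
    × (∀ t₁ t₂ → EulerTrail G₁ t₁ → EulerTrail G₂ t₂
        → d ≤ edit (str G₁ t₁) (str G₂ t₂))

is : ∀ {n} → Fin n → Fin n → Bool
is u v = ⌊ u ≟F v ⌋

-- whether the edge s → (v₁,v₂) exists / whether (v₁,v₂) → t exists
-- (cases (a), (a) symmetric, (b), (c) of the construction)
sEdgeF tEdgeF : {A : Set} (G₁ G₂ : Graph A) → Ends G₁ → Ends G₂
  → Fin (Graph.nV G₁) → Fin (Graph.nV G₂) → Bool
sEdgeF G₁ G₂ (openE a₁ _ _ _) (closedE _ _)    v₁ v₂ = is v₁ a₁
sEdgeF G₁ G₂ (closedE _ _)    (openE a₂ _ _ _) v₁ v₂ = is v₂ a₂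
sEdgeF G₁ G₂ (closedE a₁ _)   (closedE a₂ _)   v₁ v₂ = is v₁ a₁ ∨ is v₂ a₂
sEdgeF G₁ G₂ (openE a₁ _ _ _) (openE a₂ _ _ _) v₁ v₂ = is v₁ a₁ ∧ is v₂ a₂
tEdgeF G₁ G₂ (openE _ b₁ _ _) (closedE _ _)    v₁ v₂ = is v₁ b₁
tEdgeF G₁ G₂ (closedE _ _)    (openE _ b₂ _ _) v₁ v₂ = is v₂ b₂
tEdgeF G₁ G₂ (closedE a₁ _)   (closedE a₂ _)   v₁ v₂ = is v₁ a₁ ∨ is v₂ a₂
tEdgeF G₁ G₂ (openE _ b₁ _ _) (openE _ b₂ _ _) v₁ v₂ = is v₁ b₁ ∧ is v₂ b₂

module Align {A : Set} (_≟A_ : DecidableEquality A)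
             (G₁ G₂ : Graph A) (en₁ : Ends G₁) (en₂ : Ends G₂) where
  open Graph G₁ renaming (nV to n₁; nE to m₁; src to src₁; tgt to tgt₁; lab to lab₁)
  open Graph G₂ renaming (nV to n₂; nE to m₂; src to src₂; tgt to tgt₂; lab to lab₂)

  sEdge tEdge : Fin n₁ → Fin n₂ → Bool
  sEdge = sEdgeF G₁ G₂ en₁ en₂
  tEdge = tEdgeF G₁ G₂ en₁ en₂

  -- an assignment x ∈ ℕ^E, split by edge kind:
  --  xv e₁ u₂   : vertical edge [(src e₁,u₂),(tgt e₁,u₂)]
  --  xh u₁ e₂   : horizontal edge [(u₁,src e₂),(u₁,tgt e₂)]
  --  xd e₁ e₂   : diagonal edge [(src e₁,src e₂),(tgt e₁,tgt e₂)]
  --  xs v₁ v₂   : edge [s,(v₁,v₂)]     (only meaningful when sEdge v₁ v₂)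
  --  xt v₁ v₂   : edge [(v₁,v₂),t]     (only meaningful when tEdge v₁ v₂)
  record Assign : Set where
    field
      xv : Fin m₁ → Fin n₂ → ℕ
      xh : Fin n₁ → Fin m₂ → ℕ
      xd : Fin m₁ → Fin m₂ → ℕ
      xs : Fin n₁ → Fin n₂ → ℕ
      xt : Fin n₁ → Fin n₂ → ℕ

  δd : Fin m₁ → Fin m₂ → ℕ
  δd e₁ e₂ = mismatch _≟A_ (lab₁ e₁) (lab₂ e₂)

  module _ (x : Assign) where
    open Assign x

    cost : ℕ
    cost = sumF m₁ (λ e → sumF n₂ (λ u → xv e u))
         + sumF n₁ (λ u → sumF m₂ (λ e → xh u e))
         + sumF m₁ (λ e → sumF m₂ (λ f → xd e f * δd e f))

    inflow outflow : Fin n₁ → Fin n₂ → ℕ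
    inflow v₁ v₂ =
        sumF m₁ (λ e → if is (tgt₁ e) v₁ then xv e v₂ else 0)
      + sumF m₂ (λ f → if is (tgt₂ f) v₂ then xh v₁ f else 0)
      + sumF m₁ (λ e → sumF m₂ (λ f →
          if is (tgt₁ e) v₁ ∧ is (tgt₂ f) v₂ then xd e f else 0))
      + xs v₁ v₂
    outflow v₁ v₂ =
        sumF m₁ (λ e → if is (src₁ e) v₁ then xv e v₂ else 0)
      + sumF m₂ (λ f → if is (src₂ f) v₂ then xh v₁ f else 0)
      + sumF m₁ (λ e → sumF m₂ (λ f →
          if is (src₁ e) v₁ ∧ is (src₂ f) v₂ then xd e f else 0))
      + xt v₁ v₂

    record Feasible : Set where
      field
        -- x is supported on the edges of the modified alignment graph
        s-absent : ∀ v₁ v₂ → sEdge v₁ v₂ ≡ false → xs v₁ v₂ ≡ 0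
        t-absent : ∀ v₁ v₂ → tEdge v₁ v₂ ≡ false → xt v₁ v₂ ≡ 0
        cover₁ : ∀ f → sumF n₂ (λ u → xv f u) + sumF m₂ (λ g → xd f g) ≡ 1
        cover₂ : ∀ f → sumF n₁ (λ u → xh u f) + sumF m₁ (λ g → xd g f) ≡ 1
        source : sumF n₁ (λ v₁ → sumF n₂ (λ v₂ → xs v₁ v₂)) ≡ 1
        sink   : sumF n₁ (λ v₁ → sumF n₂ (λ v₂ → xt v₁ v₂)) ≡ 1
        conserve : ∀ v₁ v₂ → inflow v₁ v₂ ≡ outflow v₁ v₂

    data Node : Set where
      s t  : Node
      node : Fin n₁ → Fin n₂ → Node

    data SuppEdge : Node → Node → Set where
      vertE : ∀ e u → 1 ≤ xv e u → SuppEdge (node (src₁ e) u) (node (tgt₁ e) u)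
      horE  : ∀ u f → 1 ≤ xh u f → SuppEdge (node u (src₂ f)) (node u (tgt₂ f))
      diagE : ∀ e f → 1 ≤ xd e f → SuppEdge (node (src₁ e) (src₂ f)) (node (tgt₁ e) (tgt₂ f))
      sE    : ∀ v₁ v₂ → sEdge v₁ v₂ ≡ true → 1 ≤ xs v₁ v₂ → SuppEdge s (node v₁ v₂)
      tE    : ∀ v₁ v₂ → tEdge v₁ v₂ ≡ true → 1 ≤ xt v₁ v₂ → SuppEdge (node v₁ v₂) t

    SuppAdj : Node → Node → Set
    SuppAdj a b = SuppEdge a b ⊎ SuppEdge b a

    InSupp : Node → Set
    InSupp a = ∃ λ b → SuppAdj a b

    OneComponent : Set
    OneComponent = (∃ InSupp) × (∀ a b → InSupp a → InSupp b → Star SuppAdj a b)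

  IsOptValue : ℕ → Set
  IsOptValue c = (∃ λ x → Feasible x × cost x ≡ c)
               × (∀ y → Feasible y → c ≤ cost y)

-- A feasible x whose support is connected is the edge multiset of a connected multigraph in
-- which s has out-degree one, t in-degree one and every other vertex is balanced, so it is
-- traversed by an Eulerian s–t trail (Hierholzer).  The vertical, horizontal and diagonal steps
-- of that trail project to Eulerian trails t₁, t₂ of G₁ and G₂ (the covering constraints say
-- that each edge is used exactly once) and spell out an alignment of str t₁ with str t₂, so
-- GTED ≤ cost x.  Conversely, an optimal alignment of the strings of two Eulerian trails is a
-- walk in the alignment graph; attached to s and t (when both trails are closed, after rotating
-- it to a vertex (a₁, u), which it passes because G₁ is connected) its edge counts form a
-- connected feasible solution of cost GTED.  So a connected optimal solution costs GTED, and
-- when the optimum equals GTED that solution is a connected optimal one.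

module Submission where

open import Defs
open import Data.Nat using (ℕ)
open import Data.Product using (∃; _×_)
open import Function.Bundles using (_⇔_)
open import Relation.Binary.Definitions using (DecidableEquality)
open import Relation.Binary.PropositionalEquality using (_≡_)

open import Data.Bool using (Bool; true; false; if_then_else_; _∧_; _∨_)
open import Data.Empty using (⊥-elim)
open import Data.Fin using (Fin; zero; suc) renaming (_≟_ to _≟F_)
open import Data.Fin.Properties using (suc-injective)
open import Data.List using (List; []; _∷_; _++_; [_]; length; map; mapMaybe; allFin; tabulate; replicate)
open import Data.List.Properties using (map-++; map-cong; map-tabulate; mapMaybe-++; ++-assoc; ++-identityʳ; length-++)
open import Data.List.Membership.Propositional using (_∈_)
open import Data.List.Membership.Propositional.Properties using (∈-∃++; ∈-++⁻; ∈-++⁺ˡ; ∈-++⁺ʳ; ∈-allFin)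
open import Data.List.Relation.Unary.Any using (here; there)
open import Data.List.Relation.Unary.All using (All; []; _∷_)
import Data.List.Relation.Unary.All as All
open import Data.List.Relation.Unary.All.Properties using () renaming (++⁺ to All-++⁺)
open import Data.List.Relation.Binary.Permutation.Propositional
  using (_↭_; ↭-refl; ↭-sym; ↭-trans; ↭-reflexive; prep; module PermutationReasoning)
open import Data.List.Relation.Binary.Permutation.Propositional.Properties
  using (map⁺; mapMaybe-↭; shift; shifts; ++⁺ˡ; ++-comm; ∈-resp-↭; ↭-length)
open import Data.Maybe using (Maybe; just; nothing; maybe)
open import Data.Nat using (zero; suc; _+_; _*_; _≤_; _⊓_; z≤n; s≤s)
open import Data.Nat.ListAction using (sum)
open import Data.Nat.ListAction.Properties using (sum-↭; sum-++)
open import Data.Nat.Properties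
  using ( +-assoc; +-comm; +-identityʳ; +-cancelˡ-≡; +-cancelʳ-≡; *-identityʳ; *-zeroʳ; *-distribʳ-+
        ; ≤-refl; ≤-reflexive; ≤-trans; ≤-antisym; ≤-pred; n≮0; m≤m+n; m≤n+m; +-monoʳ-≤
        ; m⊓n≤m; m⊓n≤n; ⊓-sel; +-commutativeSemigroup)
open import Algebra.Properties.CommutativeSemigroup +-commutativeSemigroup using (interchange; x∙yz≈y∙xz)
open import Data.Product using (∃₂; _,_; proj₁; proj₂)
import Data.Product as Prod
open import Data.Sum using (_⊎_; inj₁; inj₂)
import Data.Sum as Sum
open import Data.Unit using (⊤; tt)
open import Function using (_∘_; id)
open import Function.Bundles using (Equivalence; mk⇔)
open import Relation.Binary.Construct.Closure.ReflexiveTransitive using (Star; ε; _◅_; _◅◅_; gmap)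
import Relation.Binary.Construct.Closure.ReflexiveTransitive as Star
open import Relation.Binary.PropositionalEquality hiding ([_])
open import Relation.Nullary using (¬_; yes; no; _because_; contradiction)
open import Relation.Nullary.Reflects using (Reflects; ofʸ; ofⁿ)

-- Sums and multiplicities

𝟙 : Bool → ℕ
𝟙 true  = 1
𝟙 false = 0

*-𝟙 : ∀ y b → y * 𝟙 b ≡ (if b then y else 0)
*-𝟙 y true  = *-identityʳ y
*-𝟙 y false = *-zeroʳ y

+-reassoc : ∀ a b c d → a + (b + (c + d)) ≡ a + b + c + d
+-reassoc a b c d = sym (trans (+-assoc (a + b) c d) (+-assoc a b (c + d)))

sumF-cong : ∀ n {f g : Fin n → ℕ} → (∀ i → f i ≡ g i) → sumF n f ≡ sumF n g
sumF-cong zero    h = refl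
sumF-cong (suc n) h = cong₂ _+_ (h zero) (sumF-cong n (h ∘ suc))

sumF-+ : ∀ n (f g : Fin n → ℕ) → sumF n (λ i → f i + g i) ≡ sumF n f + sumF n g
sumF-+ zero    f g = refl
sumF-+ (suc n) f g =
  trans (cong (f zero + g zero +_) (sumF-+ n (f ∘ suc) (g ∘ suc))) (interchange (f zero) (g zero) _ _)

sumF-zero : ∀ n {f : Fin n → ℕ} → (∀ i → f i ≡ 0) → sumF n f ≡ 0
sumF-zero zero    h = refl
sumF-zero (suc n) h = cong₂ _+_ (h zero) (sumF-zero n (h ∘ suc))

sumF-point : ∀ n {f : Fin n → ℕ} j → (∀ i → ¬ i ≡ j → f i ≡ 0) → sumF n f ≡ f j
sumF-point (suc n) {f} zero h =
  trans (cong (f zero +_) (sumF-zero n (λ i → h (suc i) λ ()))) (+-identityʳ (f zero))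
sumF-point (suc n) (suc j) h =
  cong₂ _+_ (h zero λ ()) (sumF-point n j (λ i i≢j → h (suc i) (i≢j ∘ suc-injective)))

sumF-pos : ∀ n (f : Fin n → ℕ) → 1 ≤ sumF n f → ∃ λ i → 1 ≤ f i
sumF-pos (suc n) f h with f zero in eq
... | suc _ = zero , subst (1 ≤_) (sym eq) (s≤s z≤n)
... | zero with sumF-pos n (f ∘ suc) h
...   | i , pos = suc i , pos

module _ {E : Set} where

  sum-map-cong : ∀ {w w′ : E → ℕ} → (∀ a → w a ≡ w′ a) → ∀ L → sum (map w L) ≡ sum (map w′ L)
  sum-map-cong h L = cong sum (map-cong h L)

  sum-map-++ : ∀ (w : E → ℕ) L M → sum (map w (L ++ M)) ≡ sum (map w L) + sum (map w M)
  sum-map-++ w L M = trans (cong sum (map-++ w L M)) (sum-++ (map w L) (map w M))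

  sum-map-↭ : ∀ (w : E → ℕ) {L M} → L ↭ M → sum (map w L) ≡ sum (map w M)
  sum-map-↭ w p = sum-↭ (map⁺ w p)

  sum-map-zero : ∀ {w : E → ℕ} → (∀ a → w a ≡ 0) → ∀ L → sum (map w L) ≡ 0
  sum-map-zero h []      = refl
  sum-map-zero h (a ∷ L) = cong₂ _+_ (h a) (sum-map-zero h L)

  sum-map-∈ : ∀ (w : E → ℕ) {a L} → a ∈ L → w a ≤ sum (map w L)
  sum-map-∈ w {L = b ∷ L} (here refl) = m≤m+n (w b) _
  sum-map-∈ w {L = b ∷ L} (there a∈L) = ≤-trans (sum-map-∈ w a∈L) (m≤n+m _ (w b))

  sum-map-pos : ∀ (w : E → ℕ) L → 1 ≤ sum (map w L) → ∃ λ a → a ∈ L × 1 ≤ w a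
  sum-map-pos w (a ∷ L) h with w a in eq
  ... | suc _ = a , here refl , subst (1 ≤_) (sym eq) (s≤s z≤n)
  ... | zero with sum-map-pos w L h
  ...   | b , b∈L , pos = b , there b∈L , pos

  sum-map-*ʳ : ∀ (w : E → ℕ) k L → sum (map w L) * k ≡ sum (map (λ a → w a * k) L)
  sum-map-*ʳ w k []      = refl
  sum-map-*ʳ w k (a ∷ L) = trans (*-distribʳ-+ k (w a) _) (cong (w a * k +_) (sum-map-*ʳ w k L))

sum-map-mapMaybe : ∀ {B E : Set} (w : B → ℕ) (p : E → Maybe B) L →
  sum (map w (mapMaybe p L)) ≡ sum (map (maybe w 0 ∘ p) L)
sum-map-mapMaybe w p []      = refl
sum-map-mapMaybe w p (a ∷ L) with p a
... | just b  = cong (w b +_) (sum-map-mapMaybe w p L)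
... | nothing = sum-map-mapMaybe w p L

∈-mapMaybe⁻ : ∀ {A B : Set} (p : A → Maybe B) {b} xs → b ∈ mapMaybe p xs → ∃ λ a → a ∈ xs × p a ≡ just b
∈-mapMaybe⁻ p (x ∷ xs) b∈ with p x in eq
... | nothing = Prod.map₂ (Prod.map₁ there) (∈-mapMaybe⁻ p xs b∈)
... | just y with b∈
...   | here refl = x , here refl , eq
...   | there b∈′ = Prod.map₂ (Prod.map₁ there) (∈-mapMaybe⁻ p xs b∈′)

sum-tabulate : ∀ n (f : Fin n → ℕ) → sum (tabulate f) ≡ sumF n f
sum-tabulate zero    f = refl
sum-tabulate (suc n) f = cong (f zero +_) (sum-tabulate n (f ∘ suc))

sum-map-allFin : ∀ n (w : Fin n → ℕ) → sum (map w (allFin n)) ≡ sumF n w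
sum-map-allFin n w = trans (cong sum (map-tabulate (λ i → i) w)) (sum-tabulate n w)

module BooleanEquality {N : Set} (_==_ : N → N → Bool) (==-reflects : ∀ v w → Reflects (v ≡ w) (v == w)) where

  ==-refl : ∀ v → (v == v) ≡ true
  ==-refl v with v == v | ==-reflects v v
  ... | true  | _      = refl
  ... | false | ofⁿ ¬p = ⊥-elim (¬p refl)

  ==-≢ : ∀ {v w} → ¬ v ≡ w → (v == w) ≡ false
  ==-≢ {v} {w} v≢w with v == w | ==-reflects v w
  ... | true  | ofʸ p = ⊥-elim (v≢w p)
  ... | false | _     = refl

  𝟙==⇒≡ : ∀ v w → 1 ≤ 𝟙 (v == w) → v ≡ w
  𝟙==⇒≡ v w h with v == w | ==-reflects v w
  ... | true | ofʸ p = p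
  𝟙==⇒≡ v w () | false | _

  multiplicity : N → List N → ℕ
  multiplicity a L = sum (map (λ b → 𝟙 (b == a)) L)

  multiplicity-pos⇒∈ : ∀ a L → 1 ≤ multiplicity a L → a ∈ L
  multiplicity-pos⇒∈ a L h with sum-map-pos (λ b → 𝟙 (b == a)) L h
  ... | b , b∈L , pos rewrite 𝟙==⇒≡ b a pos = b∈L

  ∈⇒multiplicity-pos : ∀ {a L} → a ∈ L → 1 ≤ multiplicity a L
  ∈⇒multiplicity-pos {a} {L} a∈L = subst (_≤ multiplicity a L) (cong 𝟙 (==-refl a)) (sum-map-∈ (λ b → 𝟙 (b == a)) a∈L)

  multiplicity⇒↭ : ∀ L M → (∀ a → multiplicity a L ≡ multiplicity a M) → L ↭ M
  multiplicity⇒↭ []      []      h = ↭-refl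
  multiplicity⇒↭ []      (b ∷ M) h with trans (h b) (cong (λ c → 𝟙 c + multiplicity b M) (==-refl b))
  ... | ()
  multiplicity⇒↭ (a ∷ L) M h
    with ∈-∃++ (multiplicity-pos⇒∈ a M (subst (1 ≤_) (h a) (∈⇒multiplicity-pos {L = a ∷ L} (here refl))))
  ... | M₁ , M₂ , refl = ↭-trans (prep a (multiplicity⇒↭ L (M₁ ++ M₂) h′)) (↭-sym (shift a M₁ M₂))
    where
    h′ : ∀ b → multiplicity b L ≡ multiplicity b (M₁ ++ M₂)
    h′ b = +-cancelˡ-≡ (𝟙 (a == b)) _ _ (begin
      𝟙 (a == b) + multiplicity b L                                ≡⟨ h b ⟩
      multiplicity b (M₁ ++ a ∷ M₂)                               ≡⟨ sum-map-++ (λ c → 𝟙 (c == b)) M₁ (a ∷ M₂) ⟩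
      multiplicity b M₁ + (𝟙 (a == b) + multiplicity b M₂)        ≡⟨ x∙yz≈y∙xz (multiplicity b M₁) (𝟙 (a == b)) _ ⟩
      𝟙 (a == b) + (multiplicity b M₁ + multiplicity b M₂)        ≡⟨ cong (𝟙 (a == b) +_) (sym (sum-map-++ (λ c → 𝟙 (c == b)) M₁ M₂)) ⟩
      𝟙 (a == b) + multiplicity b (M₁ ++ M₂)                      ∎)
      where open ≡-Reasoning

pair-reflects : ∀ {X Y C : Set} (c : X → Y → C) → (∀ {x y x′ y′} → c x y ≡ c x′ y′ → x ≡ x′ × y ≡ y′) →
  ∀ {x y x′ y′ b b′} → Reflects (x ≡ x′) b → Reflects (y ≡ y′) b′ → Reflects (c x y ≡ c x′ y′) (b ∧ b′)
pair-reflects c c-injective (ofʸ refl) (ofʸ refl) = ofʸ refl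
pair-reflects c c-injective (ofʸ _)    (ofⁿ y≢y′) = ofⁿ (y≢y′ ∘ Prod.proj₂ ∘ c-injective)
pair-reflects c c-injective (ofⁿ x≢x′) _          = ofⁿ (x≢x′ ∘ Prod.proj₁ ∘ c-injective)

is-reflects : ∀ {n} (u v : Fin n) → Reflects (u ≡ v) (is u v)
is-reflects u v with u ≟F v
... | true  because r = r
... | false because r = r

module _ {n : ℕ} where
  open BooleanEquality (is {n}) is-reflects public
    using (multiplicity; multiplicity⇒↭) renaming (==-refl to is-refl; ==-≢ to is-≢)

is-≢ˡ : ∀ {n} {u v : Fin n} → ¬ v ≡ u → is u v ≡ false
is-≢ˡ v≢u = is-≢ (λ u≡v → v≢u (sym u≡v))

multiplicity-allFin : ∀ n (f : Fin n) → multiplicity f (allFin n) ≡ 1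
multiplicity-allFin n f = trans (sum-map-allFin n (λ i → 𝟙 (is i f)))
  (trans (sumF-point n f (λ i i≢f → cong 𝟙 (is-≢ i≢f))) (cong 𝟙 (is-refl f)))

sumF-if-select : ∀ n (y : Fin n → ℕ) j → sumF n (λ i → if is i j then y i else 0) ≡ y j
sumF-if-select n y j =
  trans (sumF-point n j (λ i i≢j → cong (λ b → if b then y i else 0) (is-≢ i≢j)))
        (cong (λ b → if b then y j else 0) (is-refl j))

sumF-select : ∀ n (y : Fin n → ℕ) j → sumF n (λ i → y i * 𝟙 (is i j)) ≡ y j
sumF-select n y j = trans (sumF-cong n (λ i → *-𝟙 (y i) (is i j))) (sumF-if-select n y j)

sumF-select′ : ∀ n (y : Fin n → ℕ) j → sumF n (λ i → 𝟙 (is j i) * y i) ≡ y j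
sumF-select′ n y j =
  trans (sumF-point n j (λ i i≢j → cong (λ b → 𝟙 b * y i) (is-≢ˡ i≢j)))
        (trans (cong (λ b → 𝟙 b * y j) (is-refl j)) (+-identityʳ (y j)))

Σ² : ∀ n m → (Fin n → Fin m → ℕ) → ℕ
Σ² n m f = sumF n (λ i → sumF m (f i))

Σ²-cong : ∀ n m {f g : Fin n → Fin m → ℕ} → (∀ i j → f i j ≡ g i j) → Σ² n m f ≡ Σ² n m g
Σ²-cong n m h = sumF-cong n (λ i → sumF-cong m (h i))

Σ²-zero : ∀ n m {f : Fin n → Fin m → ℕ} → (∀ i j → f i j ≡ 0) → Σ² n m f ≡ 0
Σ²-zero n m h = sumF-zero n (λ i → sumF-zero m (h i))

Σ²-0 : ∀ n m → Σ² n m (λ _ _ → 0) ≡ 0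
Σ²-0 n m = Σ²-zero n m (λ _ _ → refl)

Σ²-*0 : ∀ n m (y : Fin n → Fin m → ℕ) → Σ² n m (λ i j → y i j * 0) ≡ 0
Σ²-*0 n m y = Σ²-zero n m (λ i j → *-zeroʳ (y i j))

Σ²-*1 : ∀ n m (y : Fin n → Fin m → ℕ) → Σ² n m (λ i j → y i j * 1) ≡ Σ² n m y
Σ²-*1 n m y = Σ²-cong n m (λ i j → *-identityʳ (y i j))

Σ²-+ : ∀ n m (f g : Fin n → Fin m → ℕ) → Σ² n m (λ i j → f i j + g i j) ≡ Σ² n m f + Σ² n m g
Σ²-+ n m f g = trans (sumF-cong n (λ i → sumF-+ m (f i) (g i))) (sumF-+ n _ _)

Σ²-row : ∀ n m {f : Fin n → Fin m → ℕ} k → (∀ i → ¬ i ≡ k → ∀ j → f i j ≡ 0) → Σ² n m f ≡ sumF m (f k)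
Σ²-row n m k h = sumF-point n k (λ i i≢k → sumF-zero m (h i i≢k))

Σ²-fix₁ : ∀ n m (y : Fin n → Fin m → ℕ) v (q : Fin m → Bool) →
  Σ² n m (λ i j → y i j * 𝟙 (is i v ∧ q j)) ≡ sumF m (λ j → if q j then y v j else 0)
Σ²-fix₁ n m y v q =
  trans (Σ²-row n m v (λ i i≢v j → trans (cong (λ b → y i j * 𝟙 (b ∧ q j)) (is-≢ i≢v)) (*-zeroʳ (y i j))))
        (sumF-cong m (λ j → trans (cong (λ b → y v j * 𝟙 (b ∧ q j)) (is-refl v)) (*-𝟙 (y v j) (q j))))

Σ²-fix₂ : ∀ n m (y : Fin n → Fin m → ℕ) (p : Fin n → Bool) w →
  Σ² n m (λ i j → y i j * 𝟙 (p i ∧ is j w)) ≡ sumF n (λ i → if p i then y i w else 0)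
Σ²-fix₂ n m y p w = sumF-cong n (λ i → fix (p i) (y i))
  where
  fix : ∀ b (z : Fin m → ℕ) → sumF m (λ j → z j * 𝟙 (b ∧ is j w)) ≡ (if b then z w else 0)
  fix true  z = sumF-select m z w
  fix false z = sumF-zero m (λ j → *-zeroʳ (z j))

Σ²-fix₁′ : ∀ n m (y : Fin n → Fin m → ℕ) v → Σ² n m (λ i j → y i j * 𝟙 (is i v)) ≡ sumF m (y v)
Σ²-fix₁′ n m y v =
  trans (Σ²-row n m v (λ i i≢v j → trans (cong (λ b → y i j * 𝟙 b) (is-≢ i≢v)) (*-zeroʳ (y i j))))
        (sumF-cong m (λ j → trans (cong (λ b → y v j * 𝟙 b) (is-refl v)) (*-identityʳ (y v j))))

Σ²-fix₂′ : ∀ n m (y : Fin n → Fin m → ℕ) w → Σ² n m (λ i j → y i j * 𝟙 (is j w)) ≡ sumF n (λ i → y i w)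
Σ²-fix₂′ n m y w = sumF-cong n (λ i → sumF-select m (y i) w)

Σ²-select : ∀ n m (y : Fin n → Fin m → ℕ) v w → Σ² n m (λ i j → y i j * 𝟙 (is i v ∧ is j w)) ≡ y v w
Σ²-select n m y v w = trans (Σ²-fix₁ n m y v (λ j → is j w)) (sumF-if-select m (y v) w)

Σ²-point : ∀ n m (h : Fin n → Fin m → ℕ) k l → Σ² n m (λ i j → 𝟙 (is k i ∧ is l j) * h i j) ≡ h k l
Σ²-point n m h k l =
  trans (Σ²-row n m k (λ i i≢k j → cong (λ b → 𝟙 (b ∧ is l j) * h i j) (is-≢ˡ i≢k)))
  (trans (sumF-cong m (λ j → cong (λ b → 𝟙 (b ∧ is l j) * h k j) (is-refl k)))
         (sumF-select′ m (h k) l))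

module _ {E : Set} where

  concatF : ∀ n → (Fin n → List E) → List E
  concatF zero    L = []
  concatF (suc n) L = L zero ++ concatF n (L ∘ suc)

  sum-map-concatF : ∀ n (L : Fin n → List E) (h : E → ℕ) →
    sum (map h (concatF n L)) ≡ sumF n (λ i → sum (map h (L i)))
  sum-map-concatF zero    L h = refl
  sum-map-concatF (suc n) L h =
    trans (sum-map-++ h (L zero) _) (cong (sum (map h (L zero)) +_) (sum-map-concatF n (L ∘ suc) h))

  ∈-concatF⁻ : ∀ n (L : Fin n → List E) {a} → a ∈ concatF n L → ∃ λ i → a ∈ L i
  ∈-concatF⁻ (suc n) L a∈ with ∈-++⁻ (L zero) a∈
  ... | inj₁ a∈L₀ = zero , a∈L₀
  ... | inj₂ a∈   = Prod.map suc id (∈-concatF⁻ n (L ∘ suc) a∈)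

  ∈-concatF⁺ : ∀ n (L : Fin n → List E) {a} i → a ∈ L i → a ∈ concatF n L
  ∈-concatF⁺ (suc n) L zero    a∈ = ∈-++⁺ˡ a∈
  ∈-concatF⁺ (suc n) L (suc i) a∈ = ∈-++⁺ʳ (L zero) (∈-concatF⁺ n (L ∘ suc) i a∈)

  replicas : ∀ n m → (Fin n → Fin m → ℕ) → (Fin n → Fin m → E) → List E
  replicas n m y c = concatF n (λ i → concatF m (λ j → replicate (y i j) (c i j)))

  sum-map-replicas : ∀ n m y c (h : E → ℕ) → sum (map h (replicas n m y c)) ≡ Σ² n m (λ i j → y i j * h (c i j))
  sum-map-replicas n m y c h =
    trans (sum-map-concatF n _ h) (sumF-cong n (λ i →
      trans (sum-map-concatF m _ h) (sumF-cong m (λ j → sum-map-replicate (y i j) (c i j)))))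
    where
    sum-map-replicate : ∀ k a → sum (map h (replicate k a)) ≡ k * h a
    sum-map-replicate zero    a = refl
    sum-map-replicate (suc k) a = cong (h a +_) (sum-map-replicate k a)

  ∈-replicas-pos : ∀ n m (μ : E → ℕ) c {a} → a ∈ replicas n m (λ i j → μ (c i j)) c → 1 ≤ μ a
  ∈-replicas-pos n m μ c a∈ with ∈-concatF⁻ n _ a∈
  ... | i , a∈ᵢ with ∈-concatF⁻ m _ a∈ᵢ
  ...   | j , a∈ᵢⱼ = subst (λ b → 1 ≤ μ b) (sym (∈-replicate⁻ a∈ᵢⱼ)) (replicate-pos a∈ᵢⱼ)
    where
    ∈-replicate⁻ : ∀ {k a b} → a ∈ replicate k b → a ≡ b
    ∈-replicate⁻ {suc k} (here a≡b) = a≡b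
    ∈-replicate⁻ {suc k} (there a∈) = ∈-replicate⁻ a∈
    replicate-pos : ∀ {k a b} → a ∈ replicate k b → 1 ≤ k
    replicate-pos {suc k} _ = s≤s z≤n

  ∈-replicas⁺ : ∀ n m y c i j → 1 ≤ y i j → c i j ∈ replicas n m y c
  ∈-replicas⁺ n m y c i j pos = ∈-concatF⁺ n _ i (∈-concatF⁺ m _ j (here-replicate pos))
    where
    here-replicate : ∀ {k a} → 1 ≤ k → a ∈ replicate k a
    here-replicate {suc k} _ = here refl

-- Walks and Eulerian trails in directed multigraphs

module Walks {N E : Set} (_==_ : N → N → Bool) (==-reflects : ∀ v w → Reflects (v ≡ w) (v == w))
             (tail head : E → N) where

  open BooleanEquality _==_ ==-reflects using (==-refl; ==-≢; 𝟙==⇒≡)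

  _≟_ : DecidableEquality N
  v ≟ w = (v == w) because ==-reflects v w

  Walk : N → List E → N → Set
  Walk a []      b = a ≡ b
  Walk a (e ∷ W) b = tail e ≡ a × Walk (head e) W b

  walk-++ : ∀ {a b c} W {W′} → Walk a W b → Walk b W′ c → Walk a (W ++ W′) c
  walk-++ []      refl     w′ = w′
  walk-++ (e ∷ W) (p , w) w′ = p , walk-++ W w w′

  walk-split : ∀ {a b g} W → Walk a W b → g ∈ W →
    ∃₂ λ W₁ W₂ → W ≡ W₁ ++ g ∷ W₂ × Walk a W₁ (tail g) × Walk (head g) W₂ b
  walk-split (e ∷ W) (refl , w) (here refl) = [] , W , refl , refl , w
  walk-split (e ∷ W) (refl , w) (there g∈W) with walk-split W w g∈W
  ... | W₁ , W₂ , refl , w₁ , w₂ = e ∷ W₁ , W₂ , refl , (refl , w₁) , w₂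

  Visits : N → List E → N → N → Set
  Visits a W b v = ∃₂ λ W₁ W₂ → W ≡ W₁ ++ W₂ × Walk a W₁ v × Walk v W₂ b

  visits-tail : ∀ {a b g} W → Walk a W b → g ∈ W → Visits a W b (tail g)
  visits-tail W w g∈W with walk-split W w g∈W
  ... | W₁ , W₂ , eq , w₁ , w₂ = W₁ , _ ∷ W₂ , eq , w₁ , (refl , w₂)

  visits-head : ∀ {a b g} W → Walk a W b → g ∈ W → Visits a W b (head g)
  visits-head {g = g} W w g∈W with walk-split W w g∈W
  ... | W₁ , W₂ , eq , w₁ , w₂ =
    W₁ ++ [ g ] , W₂ , trans eq (sym (++-assoc W₁ [ g ] W₂)) , walk-++ W₁ w₁ (refl , refl) , w₂

  walk-reaches : ∀ {R : N → N → Set} {a b} W → Walk a W b → (∀ {g} → g ∈ W → R (tail g) (head g)) →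
    ∀ {g} → g ∈ W → Star R a (tail g) × Star R a (head g)
  walk-reaches (g ∷ W) (refl , w) edge (here refl) = ε , edge (here refl) ◅ ε
  walk-reaches (g ∷ W) (refl , w) edge (there g∈W) =
    Prod.map (edge (here refl) ◅_) (edge (here refl) ◅_) (walk-reaches W w (edge ∘ there) g∈W)

  outdeg indeg : N → List E → ℕ
  outdeg v L = sum (map (λ e → 𝟙 (tail e == v)) L)
  indeg  v L = sum (map (λ e → 𝟙 (head e == v)) L)

  TrailDegrees : List E → N → N → Set
  TrailDegrees L a b = ∀ v → outdeg v L + 𝟙 (b == v) ≡ indeg v L + 𝟙 (a == v)

  Balanced : List E → Set
  Balanced L = ∀ v → outdeg v L ≡ indeg v L

  walk-degrees : ∀ {a b} W → Walk a W b → TrailDegrees W a b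
  walk-degrees []      refl     v = refl
  walk-degrees {b = b} (e ∷ W) (refl , w) v = begin
    x + outdeg v W + 𝟙 (b == v)   ≡⟨ +-assoc x _ _ ⟩
    x + (outdeg v W + 𝟙 (b == v)) ≡⟨ cong (x +_) (walk-degrees W w v) ⟩
    x + (indeg v W + y)           ≡⟨ +-comm x _ ⟩
    indeg v W + y + x             ≡⟨ cong (_+ x) (+-comm (indeg v W) y) ⟩
    y + indeg v W + x             ∎
    where
    open ≡-Reasoning
    x y : ℕ
    x = 𝟙 (tail e == v)
    y = 𝟙 (head e == v)

  balanced⇒degrees : ∀ {R} v → Balanced R → TrailDegrees R v v
  balanced⇒degrees v bal u = cong (_+ 𝟙 (v == u)) (bal u)

  degrees⇒balanced : ∀ {R v} → TrailDegrees R v v → Balanced R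
  degrees⇒balanced {v = v} deg u = +-cancelʳ-≡ (𝟙 (v == u)) _ _ (deg u)

  out-edge : ∀ v R → 1 ≤ outdeg v R → ∃ λ e → e ∈ R × tail e ≡ v
  out-edge v R pos with sum-map-pos (λ e → 𝟙 (tail e == v)) R pos
  ... | e , e∈R , h = e , e∈R , 𝟙==⇒≡ (tail e) v h

  degrees-remove : ∀ {e R R₀ b} → R ↭ e ∷ R₀ → TrailDegrees R (tail e) b → TrailDegrees R₀ (head e) b
  degrees-remove {e} {R} {R₀} {b} R↭ deg v = +-cancelˡ-≡ x _ _ (begin
    x + (outdeg v R₀ + 𝟙 (b == v)) ≡⟨ sym (+-assoc x _ _) ⟩
    outdeg v (e ∷ R₀) + 𝟙 (b == v) ≡⟨ cong (_+ 𝟙 (b == v)) (sum-map-↭ _ (↭-sym R↭)) ⟩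
    outdeg v R + 𝟙 (b == v)        ≡⟨ deg v ⟩
    indeg v R + x                  ≡⟨ cong (_+ x) (sum-map-↭ _ R↭) ⟩
    y + indeg v R₀ + x             ≡⟨ +-comm _ x ⟩
    x + (y + indeg v R₀)           ≡⟨ cong (x +_) (+-comm y _) ⟩
    x + (indeg v R₀ + y)           ∎)
    where
    open ≡-Reasoning
    x y : ℕ
    x = 𝟙 (tail e == v)
    y = 𝟙 (head e == v)

  outdeg-source : ∀ {R a b} → TrailDegrees R a b → ¬ a ≡ b → outdeg a R ≡ indeg a R + 1
  outdeg-source {R} {a} {b} deg a≢b = begin
    outdeg a R              ≡⟨ sym (+-identityʳ _) ⟩
    outdeg a R + 0          ≡⟨ cong (λ c → outdeg a R + 𝟙 c) (sym (==-≢ (a≢b ∘ sym))) ⟩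
    outdeg a R + 𝟙 (b == a) ≡⟨ deg a ⟩
    indeg a R + 𝟙 (a == a)  ≡⟨ cong (λ c → indeg a R + 𝟙 c) (==-refl a) ⟩
    indeg a R + 1           ∎
    where open ≡-Reasoning

  remove-out-edge : ∀ {v} R → 1 ≤ outdeg v R → ∃₂ λ e R₀ → tail e ≡ v × R ↭ e ∷ R₀
  remove-out-edge {v} R pos with out-edge v R pos
  ... | e , e∈R , tail≡v with ∈-∃++ e∈R
  ...   | R₁ , R₂ , refl = e , R₁ ++ R₂ , tail≡v , shift e R₁ R₂

  -- Walk greedily from a: the degree condition provides an unused out-edge until b is reached.
  greedy-trail : ∀ fuel R {a b} → length R ≤ fuel → TrailDegrees R a b →
    ∃₂ λ W R′ → Walk a W b × R ↭ W ++ R′ × Balanced R′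
  greedy-trail fuel R {a} {b} len deg with a ≟ b
  ... | yes refl = [] , R , refl , ↭-refl , degrees⇒balanced {R} deg
  ... | no a≢b
    with remove-out-edge {a} R (subst (1 ≤_) (sym (outdeg-source {R} deg a≢b)) (m≤n+m 1 (indeg a R)))
  ...   | e , R₀ , refl , R↭ with fuel
  ...     | suc fuel′
    with greedy-trail fuel′ R₀ (≤-pred (subst (_≤ suc fuel′) (↭-length R↭) len)) (degrees-remove {R = R} R↭ deg)
  ...       | W , R′ , w , R₀↭ , bal = e ∷ W , R′ , (refl , w) , ↭-trans R↭ (prep e R₀↭) , bal
  greedy-trail _ R len deg | no _ | e , R₀ , refl , R↭ | zero with subst (_≤ 0) (↭-length R↭) len
  ... | ()

  closed-trail : ∀ {v} R → Balanced R → 1 ≤ outdeg v R →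
    ∃ λ e → ∃₂ λ C R′ → Walk v (e ∷ C) v × R ↭ e ∷ C ++ R′ × Balanced R′
  closed-trail {v} R bal pos with remove-out-edge {v} R pos
  ... | e , R₀ , refl , R↭
    with greedy-trail (length R₀) R₀ ≤-refl (degrees-remove {R = R} R↭ (balanced⇒degrees {R} (tail e) bal))
  ...   | C , R′ , c , R₀↭ , bal′ = e , C , R′ , (refl , c) , ↭-trans R↭ (prep e R₀↭) , bal′

  balanced-outdeg-pos : ∀ R {g v} → Balanced R → g ∈ R → tail g ≡ v ⊎ head g ≡ v → 1 ≤ outdeg v R
  balanced-outdeg-pos R {g} bal g∈R (inj₁ refl) =
    subst (_≤ outdeg (tail g) R) (cong 𝟙 (==-refl (tail g))) (sum-map-∈ (λ e → 𝟙 (tail e == tail g)) g∈R)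
  balanced-outdeg-pos R {g} bal g∈R (inj₂ refl) =
    subst₂ _≤_ (cong 𝟙 (==-refl (head g))) (sym (bal (head g))) (sum-map-∈ (λ e → 𝟙 (head e == head g)) g∈R)

  Adjacent : List E → N → N → Set
  Adjacent L v w = ∃ λ g → g ∈ L × ((tail g ≡ v × head g ≡ w) ⊎ (tail g ≡ w × head g ≡ v))

  ConnectedFrom : List E → N → Set
  ConnectedFrom L s = ∀ e → e ∈ L → Star (Adjacent L) s (tail e)

  module _ (L : List E) (s t : N) where

    Touching : List E → List E → Set
    Touching W R = ∃₂ λ g v → g ∈ R × Visits s W t v × (tail g ≡ v ⊎ head g ≡ v)

    touch : ∀ {W R} → Walk s W t → W ++ R ↭ L → ∀ {v u} → Visits s W t v → Star (Adjacent L) v u →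
      Touching W R ⊎ Visits s W t u
    touch w p vis ε = inj₂ vis
    touch {W} w p vis ((g , g∈L , ends) ◅ path) with ∈-++⁻ W (∈-resp-↭ (↭-sym p) g∈L)
    ... | inj₂ g∈R = inj₁ (g , _ , g∈R , vis , incident ends)
      where
      incident : ∀ {v w} → (tail g ≡ v × head g ≡ w) ⊎ (tail g ≡ w × head g ≡ v) → tail g ≡ v ⊎ head g ≡ v
      incident (inj₁ (tg , _)) = inj₁ tg
      incident (inj₂ (_ , hg)) = inj₂ hg
    ... | inj₁ g∈W with ends
    ...   | inj₁ (refl , refl) = touch w p (visits-head W w g∈W) path
    ...   | inj₂ (refl , refl) = touch w p (visits-tail W w g∈W) path

    -- Hierholzer: while edges remain, splice a closed trail of them into W at a vertex they share.
    splice-cycles : ConnectedFrom L s → ∀ fuel W R → length R ≤ fuel → Walk s W t → Balanced R → W ++ R ↭ L →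
      ∃ λ W′ → Walk s W′ t × W′ ↭ L
    splice-cycles conn fuel W [] _ w _ p = W , w , ↭-trans (↭-reflexive (sym (++-identityʳ W))) p
    splice-cycles conn zero W (e ∷ R) () w bal p
    splice-cycles conn (suc fuel) W (e ∷ R) len w bal p with touching
      where
      touching : Touching W (e ∷ R)
      touching with touch w p ([] , W , refl , refl , w) (conn e (∈-resp-↭ p (∈-++⁺ʳ W (here refl))))
      ... | inj₁ found = found
      ... | inj₂ vis   = e , tail e , here refl , vis , inj₁ refl
    ... | g , v , g∈R , (W₁ , W₂ , refl , w₁ , w₂) , incident
      with closed-trail (e ∷ R) bal (balanced-outdeg-pos (e ∷ R) bal g∈R incident)
    ...   | e′ , C , R′ , c , R↭ , bal′ =
      splice-cycles conn fuel (W₁ ++ (e′ ∷ C) ++ W₂) R′ shorter (walk-++ W₁ w₁ (walk-++ (e′ ∷ C) c w₂)) bal′ spliced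
      where
      shorter : length R′ ≤ fuel
      shorter = ≤-pred (≤-trans (s≤s (m≤n+m (length R′) (length C)))
                  (≤-trans (≤-reflexive (sym (trans (↭-length R↭) (cong suc (length-++ C))))) len))
      spliced : (W₁ ++ (e′ ∷ C) ++ W₂) ++ R′ ↭ L
      spliced = begin
        (W₁ ++ (e′ ∷ C) ++ W₂) ++ R′   ≡⟨ ++-assoc W₁ _ R′ ⟩
        W₁ ++ ((e′ ∷ C) ++ W₂) ++ R′   ≡⟨ cong (W₁ ++_) (++-assoc (e′ ∷ C) W₂ R′) ⟩
        W₁ ++ (e′ ∷ C) ++ W₂ ++ R′     ↭⟨ ++⁺ˡ W₁ (shifts (e′ ∷ C) W₂) ⟩
        W₁ ++ W₂ ++ (e′ ∷ C) ++ R′     ↭⟨ ++⁺ˡ W₁ (++⁺ˡ W₂ (↭-sym R↭)) ⟩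
        W₁ ++ W₂ ++ e ∷ R              ≡⟨ sym (++-assoc W₁ W₂ (e ∷ R)) ⟩
        (W₁ ++ W₂) ++ e ∷ R            ↭⟨ p ⟩
        L                              ∎
        where open PermutationReasoning

    euler-trail : TrailDegrees L s t → ConnectedFrom L s → ∃ λ W → Walk s W t × W ↭ L
    euler-trail deg conn with greedy-trail (length L) L ≤-refl deg
    ... | W , R , w , L↭ , bal = splice-cycles conn (length R) W R ≤-refl w bal (↭-sym L↭)

  trail-ends : ∀ {a b a′ b′} W W′ → Walk a W b → Walk a′ W′ b′ → W ↭ W′ →
    ∀ v → 𝟙 (b == v) + 𝟙 (a′ == v) ≡ 𝟙 (a == v) + 𝟙 (b′ == v)
  trail-ends {a} {b} {a′} {b′} W W′ w w′ W↭ v = +-cancelˡ-≡ (outdeg v W) _ _ (begin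
    outdeg v W + (B + A′)   ≡⟨ sym (+-assoc (outdeg v W) B A′) ⟩
    outdeg v W + B + A′     ≡⟨ cong (_+ A′) (walk-degrees W w v) ⟩
    indeg v W + A + A′      ≡⟨ +-assoc (indeg v W) A A′ ⟩
    indeg v W + (A + A′)    ≡⟨ cong₂ _+_ (sum-map-↭ _ W↭) (+-comm A A′) ⟩
    indeg v W′ + (A′ + A)   ≡⟨ sym (+-assoc (indeg v W′) A′ A) ⟩
    indeg v W′ + A′ + A     ≡⟨ cong (_+ A) (sym (walk-degrees W′ w′ v)) ⟩
    outdeg v W′ + B′ + A    ≡⟨ +-assoc (outdeg v W′) B′ A ⟩
    outdeg v W′ + (B′ + A)  ≡⟨ cong₂ _+_ (sum-map-↭ _ (↭-sym W↭)) (+-comm B′ A) ⟩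
    outdeg v W + (A + B′)   ∎)
    where
    open ≡-Reasoning
    A B A′ B′ : ℕ
    A = 𝟙 (a == v)
    B = 𝟙 (b == v)
    A′ = 𝟙 (a′ == v)
    B′ = 𝟙 (b′ == v)

  open-trail-ends : ∀ {a b a′ b′} W W′ → ¬ a ≡ b → Walk a W b → Walk a′ W′ b′ → W ↭ W′ → a′ ≡ a × b′ ≡ b
  open-trail-ends {a} {b} {a′} {b′} W W′ a≢b w w′ W↭ =
    𝟙==⇒≡ a′ a (subst (1 ≤_) (sym at-a) (s≤s z≤n)) , 𝟙==⇒≡ b′ b (subst (1 ≤_) (sym at-b) (s≤s z≤n))
    where
    open ≡-Reasoning
    at-a : 𝟙 (a′ == a) ≡ suc (𝟙 (b′ == a))
    at-a = begin
      𝟙 (a′ == a)              ≡⟨ cong (λ c → 𝟙 c + 𝟙 (a′ == a)) (sym (==-≢ (a≢b ∘ sym))) ⟩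
      𝟙 (b == a) + 𝟙 (a′ == a) ≡⟨ trail-ends W W′ w w′ W↭ a ⟩
      𝟙 (a == a) + 𝟙 (b′ == a) ≡⟨ cong (λ c → 𝟙 c + 𝟙 (b′ == a)) (==-refl a) ⟩
      suc (𝟙 (b′ == a))        ∎
    at-b : 𝟙 (b′ == b) ≡ suc (𝟙 (a′ == b))
    at-b = begin
      𝟙 (b′ == b)              ≡⟨ cong (λ c → 𝟙 c + 𝟙 (b′ == b)) (sym (==-≢ a≢b)) ⟩
      𝟙 (a == b) + 𝟙 (b′ == b) ≡⟨ sym (trail-ends W W′ w w′ W↭ b) ⟩
      𝟙 (b == b) + 𝟙 (a′ == b) ≡⟨ cong (λ c → 𝟙 c + 𝟙 (a′ == b)) (==-refl b) ⟩
      suc (𝟙 (a′ == b))        ∎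

  closed-trail-ends : ∀ {a a′ b′} W W′ → Walk a W a → Walk a′ W′ b′ → W ↭ W′ → a′ ≡ b′
  closed-trail-ends {a} {a′} {b′} W W′ w w′ W↭ =
    sym (𝟙==⇒≡ b′ a′ (subst (1 ≤_) at-a′ (≤-reflexive (cong 𝟙 (sym (==-refl a′))))))
    where
    at-a′ : 𝟙 (a′ == a′) ≡ 𝟙 (b′ == a′)
    at-a′ = +-cancelˡ-≡ (𝟙 (a == a′)) _ _ (trail-ends W W′ w w′ W↭ a′)

module EulerTrailEnds {A : Set} (G : Graph A) where
  open Graph G
  open Walks is is-reflects src tgt

  walkFromTo⇒walk : ∀ {a b} t → WalkFromTo G a t b → Walk a t b
  walkFromTo⇒walk []      w       = w
  walkFromTo⇒walk (e ∷ t) (p , w) = p , walkFromTo⇒walk t w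

  open-euler-trail-ends : ∀ {a b a′ b′ t t′} → ¬ a ≡ b →
    EulerTrailFromTo G a t b → EulerTrailFromTo G a′ t′ b′ → a′ ≡ a × b′ ≡ b
  open-euler-trail-ends {t = t} {t′} a≢b (w , t↭) (w′ , t′↭) =
    open-trail-ends t t′ a≢b (walkFromTo⇒walk t w) (walkFromTo⇒walk t′ w′) (↭-trans t↭ (↭-sym t′↭))

  closed-euler-trail-ends : ∀ {c a′ b′ t t′} → EulerTrailFromTo G c t c → EulerTrailFromTo G a′ t′ b′ → a′ ≡ b′
  closed-euler-trail-ends {t = t} {t′} (w , t↭) (w′ , t′↭) =
    closed-trail-ends t t′ (walkFromTo⇒walk t w) (walkFromTo⇒walk t′ w′) (↭-trans t↭ (↭-sym t′↭))

-- Edit distance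

module EditProperties {A : Set} (_≟A_ : DecidableEquality A) where

  edit-[]ʳ : ∀ xs → edit _≟A_ xs [] ≡ length xs
  edit-[]ʳ []      = refl
  edit-[]ʳ (x ∷ xs) = refl

  edit-delete : ∀ x xs ys → edit _≟A_ (x ∷ xs) ys ≤ suc (edit _≟A_ xs ys)
  edit-delete x xs []       = ≤-reflexive (cong suc (sym (edit-[]ʳ xs)))
  edit-delete x xs (y ∷ ys) = m⊓n≤m _ _

  edit-insert : ∀ xs y ys → edit _≟A_ xs (y ∷ ys) ≤ suc (edit _≟A_ xs ys)
  edit-insert []       y ys = ≤-refl
  edit-insert (x ∷ xs) y ys = ≤-trans (m⊓n≤n _ _) (m⊓n≤m _ _)

  edit-substitute : ∀ x xs y ys → edit _≟A_ (x ∷ xs) (y ∷ ys) ≤ mismatch _≟A_ x y + edit _≟A_ xs ys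
  edit-substitute x xs y ys = ≤-trans (m⊓n≤n _ _) (m⊓n≤n _ _)

  edit-cases : ∀ x xs y ys →
      edit _≟A_ (x ∷ xs) (y ∷ ys) ≡ suc (edit _≟A_ xs (y ∷ ys))
    ⊎ edit _≟A_ (x ∷ xs) (y ∷ ys) ≡ suc (edit _≟A_ (x ∷ xs) ys)
    ⊎ edit _≟A_ (x ∷ xs) (y ∷ ys) ≡ mismatch _≟A_ x y + edit _≟A_ xs ys
  edit-cases x xs y ys with ⊓-sel (suc (edit _≟A_ xs (y ∷ ys)))
                                  (suc (edit _≟A_ (x ∷ xs) ys) ⊓ (mismatch _≟A_ x y + edit _≟A_ xs ys))
  ... | inj₁ del = inj₁ del
  ... | inj₂ rest with ⊓-sel (suc (edit _≟A_ (x ∷ xs) ys)) (mismatch _≟A_ x y + edit _≟A_ xs ys)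
  ...   | inj₁ ins = inj₂ (inj₁ (trans rest ins))
  ...   | inj₂ sub = inj₂ (inj₂ (trans rest sub))

-- The modified alignment graph

module Alignment {A : Set} (_≟A_ : DecidableEquality A) (G₁ G₂ : Graph A) where
  open Graph G₁ renaming (nV to n₁; nE to m₁; src to src₁; tgt to tgt₁; lab to lab₁)
  open Graph G₂ renaming (nV to n₂; nE to m₂; src to src₂; tgt to tgt₂; lab to lab₂)
  open EditProperties _≟A_
  module Ends₁ = EulerTrailEnds G₁
  module Ends₂ = EulerTrailEnds G₂

  data Vertex : Set where
    start finish : Vertex
    pt           : Fin n₁ → Fin n₂ → Vertex

  data Edge : Set where
    vert       : Fin m₁ → Fin n₂ → Edge
    horz       : Fin n₁ → Fin m₂ → Edge
    diag       : Fin m₁ → Fin m₂ → Edge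
    enter exit : Fin n₁ → Fin n₂ → Edge
  -- start and finish are the source s and sink t; enter a b and exit a b are the edges [s,(a,b)] and [(a,b),t].

  tail head : Edge → Vertex
  tail (vert e u)  = pt (src₁ e) u
  tail (horz u f)  = pt u (src₂ f)
  tail (diag e f)  = pt (src₁ e) (src₂ f)
  tail (enter _ _) = start
  tail (exit a b)  = pt a b
  head (vert e u)  = pt (tgt₁ e) u
  head (horz u f)  = pt u (tgt₂ f)
  head (diag e f)  = pt (tgt₁ e) (tgt₂ f)
  head (enter a b) = pt a b
  head (exit _ _)  = finish

  _==_ : Vertex → Vertex → Bool
  start  == start  = true
  finish == finish = true
  pt a b == pt c d = is a c ∧ is b d
  _      == _      = false

  ==-reflects : ∀ v w → Reflects (v ≡ w) (v == w)
  ==-reflects start    start    = ofʸ refl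
  ==-reflects start    finish   = ofⁿ λ ()
  ==-reflects start    (pt _ _) = ofⁿ λ ()
  ==-reflects finish   start    = ofⁿ λ ()
  ==-reflects finish   finish   = ofʸ refl
  ==-reflects finish   (pt _ _) = ofⁿ λ ()
  ==-reflects (pt _ _) start    = ofⁿ λ ()
  ==-reflects (pt _ _) finish   = ofⁿ λ ()
  ==-reflects (pt a b) (pt c d) = pair-reflects pt (λ { refl → refl , refl }) (is-reflects a c) (is-reflects b d)

  _==E_ : Edge → Edge → Bool
  vert e u  ==E vert e′ u′  = is e e′ ∧ is u u′
  horz u f  ==E horz u′ f′  = is u u′ ∧ is f f′
  diag e f  ==E diag e′ f′  = is e e′ ∧ is f f′
  enter a b ==E enter a′ b′ = is a a′ ∧ is b b′
  exit a b  ==E exit a′ b′  = is a a′ ∧ is b b′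
  _         ==E _           = false

  ==E-reflects : ∀ g g′ → Reflects (g ≡ g′) (g ==E g′)
  ==E-reflects (vert e u)  (vert e′ u′)  = pair-reflects vert  (λ { refl → refl , refl }) (is-reflects e e′) (is-reflects u u′)
  ==E-reflects (horz u f)  (horz u′ f′)  = pair-reflects horz  (λ { refl → refl , refl }) (is-reflects u u′) (is-reflects f f′)
  ==E-reflects (diag e f)  (diag e′ f′)  = pair-reflects diag  (λ { refl → refl , refl }) (is-reflects e e′) (is-reflects f f′)
  ==E-reflects (enter a b) (enter a′ b′) = pair-reflects enter (λ { refl → refl , refl }) (is-reflects a a′) (is-reflects b b′)
  ==E-reflects (exit a b)  (exit a′ b′)  = pair-reflects exit  (λ { refl → refl , refl }) (is-reflects a a′) (is-reflects b b′)
  ==E-reflects (vert _ _)  (horz _ _)    = ofⁿ λ ()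
  ==E-reflects (vert _ _)  (diag _ _)    = ofⁿ λ ()
  ==E-reflects (vert _ _)  (enter _ _)   = ofⁿ λ ()
  ==E-reflects (vert _ _)  (exit _ _)    = ofⁿ λ ()
  ==E-reflects (horz _ _)  (vert _ _)    = ofⁿ λ ()
  ==E-reflects (horz _ _)  (diag _ _)    = ofⁿ λ ()
  ==E-reflects (horz _ _)  (enter _ _)   = ofⁿ λ ()
  ==E-reflects (horz _ _)  (exit _ _)    = ofⁿ λ ()
  ==E-reflects (diag _ _)  (vert _ _)    = ofⁿ λ ()
  ==E-reflects (diag _ _)  (horz _ _)    = ofⁿ λ ()
  ==E-reflects (diag _ _)  (enter _ _)   = ofⁿ λ ()
  ==E-reflects (diag _ _)  (exit _ _)    = ofⁿ λ ()
  ==E-reflects (enter _ _) (vert _ _)    = ofⁿ λ ()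
  ==E-reflects (enter _ _) (horz _ _)    = ofⁿ λ ()
  ==E-reflects (enter _ _) (diag _ _)    = ofⁿ λ ()
  ==E-reflects (enter _ _) (exit _ _)    = ofⁿ λ ()
  ==E-reflects (exit _ _)  (vert _ _)    = ofⁿ λ ()
  ==E-reflects (exit _ _)  (horz _ _)    = ofⁿ λ ()
  ==E-reflects (exit _ _)  (diag _ _)    = ofⁿ λ ()
  ==E-reflects (exit _ _)  (enter _ _)   = ofⁿ λ ()

  open Walks _==_ ==-reflects tail head public

  δ : Edge → ℕ
  δ (vert _ _)  = 1
  δ (horz _ _)  = 1
  δ (diag e f)  = mismatch _≟A_ (lab₁ e) (lab₂ f)
  δ (enter _ _) = 0
  δ (exit _ _)  = 0

  walk-cost : List Edge → ℕ
  walk-cost W = sum (map δ W)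

  edge₁ : Edge → Maybe (Fin m₁)
  edge₁ (vert e _) = just e
  edge₁ (diag e _) = just e
  edge₁ _          = nothing

  edge₂ : Edge → Maybe (Fin m₂)
  edge₂ (horz _ f) = just f
  edge₂ (diag _ f) = just f
  edge₂ _          = nothing

  trail₁ : List Edge → List (Fin m₁)
  trail₁ = mapMaybe edge₁

  trail₂ : List Edge → List (Fin m₂)
  trail₂ = mapMaybe edge₂

  -- I₁ f g is the paper's I₁(g, f).
  I₁ : Fin m₁ → Edge → ℕ
  I₁ f = maybe (λ e → 𝟙 (is e f)) 0 ∘ edge₁

  I₂ : Fin m₂ → Edge → ℕ
  I₂ f = maybe (λ e → 𝟙 (is e f)) 0 ∘ edge₂

  covers-once₁ : ∀ W → (trail₁ W ↭ allFin m₁) ⇔ (∀ f → sum (map (I₁ f) W) ≡ 1)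
  covers-once₁ W = mk⇔
    (λ W-covers f → trans (sym (sum-map-mapMaybe (λ e → 𝟙 (is e f)) edge₁ W))
                          (trans (sum-map-↭ _ W-covers) (multiplicity-allFin m₁ f)))
    (λ once → multiplicity⇒↭ (trail₁ W) (allFin m₁) (λ f →
      trans (sum-map-mapMaybe (λ e → 𝟙 (is e f)) edge₁ W) (trans (once f) (sym (multiplicity-allFin m₁ f)))))

  covers-once₂ : ∀ W → (trail₂ W ↭ allFin m₂) ⇔ (∀ f → sum (map (I₂ f) W) ≡ 1)
  covers-once₂ W = mk⇔
    (λ W-covers f → trans (sym (sum-map-mapMaybe (λ e → 𝟙 (is e f)) edge₂ W))
                          (trans (sum-map-↭ _ W-covers) (multiplicity-allFin m₂ f)))
    (λ once → multiplicity⇒↭ (trail₂ W) (allFin m₂) (λ f →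
      trans (sum-map-mapMaybe (λ e → 𝟙 (is e f)) edge₂ W) (trans (once f) (sym (multiplicity-allFin m₂ f)))))

  edit-≤-walk-cost : ∀ W → edit _≟A_ (str G₁ (trail₁ W)) (str G₂ (trail₂ W)) ≤ walk-cost W
  edit-≤-walk-cost []              = ≤-refl
  edit-≤-walk-cost (vert e _ ∷ W)  = ≤-trans (edit-delete (lab₁ e) (str G₁ (trail₁ W)) (str G₂ (trail₂ W))) (s≤s (edit-≤-walk-cost W))
  edit-≤-walk-cost (horz _ f ∷ W)  = ≤-trans (edit-insert (str G₁ (trail₁ W)) (lab₂ f) (str G₂ (trail₂ W))) (s≤s (edit-≤-walk-cost W))
  edit-≤-walk-cost (diag e f ∷ W)  =
    ≤-trans (edit-substitute (lab₁ e) (str G₁ (trail₁ W)) (lab₂ f) (str G₂ (trail₂ W))) (+-monoʳ-≤ (δ (diag e f)) (edit-≤-walk-cost W))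
  edit-≤-walk-cost (enter _ _ ∷ W) = edit-≤-walk-cost W
  edit-≤-walk-cost (exit _ _ ∷ W)  = edit-≤-walk-cost W

  AlignmentOf : Vertex → Vertex → List (Fin m₁) → List (Fin m₂) → Set
  AlignmentOf v w t₁ t₂ = ∃ λ W → Walk v W w × trail₁ W ≡ t₁ × trail₂ W ≡ t₂
                                × walk-cost W ≡ edit _≟A_ (str G₁ t₁) (str G₂ t₂)

  alignment-step : ∀ {b} e f t₁ t₂ →
    AlignmentOf (pt (tgt₁ e) (src₂ f)) b t₁ (f ∷ t₂) →
    AlignmentOf (pt (src₁ e) (tgt₂ f)) b (e ∷ t₁) t₂ →
    AlignmentOf (pt (tgt₁ e) (tgt₂ f)) b t₁ t₂ →
    AlignmentOf (pt (src₁ e) (src₂ f)) b (e ∷ t₁) (f ∷ t₂)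
  alignment-step e f t₁ t₂ del ins sub with edit-cases (lab₁ e) (str G₁ t₁) (lab₂ f) (str G₂ t₂)
  alignment-step e f t₁ t₂ (W , w , p₁ , p₂ , c) _ _ | inj₁ del =
    vert e (src₂ f) ∷ W , (refl , w) , cong (e ∷_) p₁ , p₂ , trans (cong suc c) (sym del)
  alignment-step e f t₁ t₂ _ (W , w , p₁ , p₂ , c) _ | inj₂ (inj₁ ins) =
    horz (src₁ e) f ∷ W , (refl , w) , p₁ , cong (f ∷_) p₂ , trans (cong suc c) (sym ins)
  alignment-step e f t₁ t₂ _ _ (W , w , p₁ , p₂ , c) | inj₂ (inj₂ sub) =
    diag e f ∷ W , (refl , w) , cong (e ∷_) p₁ , cong (f ∷_) p₂ , trans (cong (δ (diag e f) +_) c) (sym sub)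

  optimal-alignment : ∀ {a₁ b₁ a₂ b₂} t₁ t₂ → WalkFromTo G₁ a₁ t₁ b₁ → WalkFromTo G₂ a₂ t₂ b₂ →
    AlignmentOf (pt a₁ a₂) (pt b₁ b₂) t₁ t₂
  optimal-alignment [] [] refl refl = [] , refl , refl , refl , refl
  optimal-alignment {a₁} [] (f ∷ t₂) refl (refl , w₂) with optimal-alignment [] t₂ refl w₂
  ... | W , w , p₁ , p₂ , c = horz a₁ f ∷ W , (refl , w) , p₁ , cong (f ∷_) p₂ , cong suc c
  optimal-alignment {a₂ = a₂} (e ∷ t₁) [] (refl , w₁) refl with optimal-alignment t₁ [] w₁ refl
  ... | W , w , p₁ , p₂ , c =
    vert e a₂ ∷ W , (refl , w) , cong (e ∷_) p₁ , p₂ , cong suc (trans c (edit-[]ʳ (str G₁ t₁)))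
  optimal-alignment (e ∷ t₁) (f ∷ t₂) (refl , w₁) (refl , w₂) =
    alignment-step e f t₁ t₂ (optimal-alignment t₁ (f ∷ t₂) w₁ (refl , w₂))
                             (optimal-alignment (e ∷ t₁) t₂ (refl , w₁) w₂)
                             (optimal-alignment t₁ t₂ w₁ w₂)

  finish-has-no-out-edge : ∀ g → ¬ tail g ≡ finish
  finish-has-no-out-edge (vert _ _)  ()
  finish-has-no-out-edge (horz _ _)  ()
  finish-has-no-out-edge (diag _ _)  ()
  finish-has-no-out-edge (enter _ _) ()
  finish-has-no-out-edge (exit _ _)  ()

  project-walk : ∀ {a₁ a₂} W → Walk (pt a₁ a₂) W finish →
    ∃₂ λ c₁ c₂ → WalkFromTo G₁ a₁ (trail₁ W) c₁ × WalkFromTo G₂ a₂ (trail₂ W) c₂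
  project-walk (vert _ _ ∷ W) (refl , w) with project-walk W w
  ... | c₁ , c₂ , w₁ , w₂ = c₁ , c₂ , (refl , w₁) , w₂
  project-walk (horz _ _ ∷ W) (refl , w) with project-walk W w
  ... | c₁ , c₂ , w₁ , w₂ = c₁ , c₂ , w₁ , (refl , w₂)
  project-walk (diag _ _ ∷ W) (refl , w) with project-walk W w
  ... | c₁ , c₂ , w₁ , w₂ = c₁ , c₂ , (refl , w₁) , (refl , w₂)
  project-walk (exit _ _ ∷ [])    (refl , refl)   = _ , _ , refl , refl
  project-walk (exit _ _ ∷ g ∷ _) (refl , tg , _) = ⊥-elim (finish-has-no-out-edge g tg)

  edge₁-ends : ∀ g {e} → edge₁ g ≡ just e → ∃₂ λ u u′ → tail g ≡ pt (src₁ e) u × head g ≡ pt (tgt₁ e) u′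
  edge₁-ends (vert e u) refl = u , u , refl , refl
  edge₁-ends (diag e f) refl = src₂ f , tgt₂ f , refl , refl

  -- Only the first step of the path matters: W covers an edge at a₁, so it passes a vertex (a₁, u).
  closed-walk-visits : ∀ {c₁ c₂ a₁} W → Walk (pt c₁ c₂) W (pt c₁ c₂) → trail₁ W ↭ allFin m₁ →
    Star (UAdj G₁) a₁ c₁ → ∃ λ u → Visits (pt c₁ c₂) W (pt c₁ c₂) (pt a₁ u)
  closed-walk-visits {c₂ = c₂} W w _ ε = c₂ , [] , W , refl , refl , w
  closed-walk-visits W w covers ((e , ends) ◅ _)
    with ∈-mapMaybe⁻ edge₁ W (∈-resp-↭ (↭-sym covers) (∈-allFin e))
  ... | g , g∈W , edge₁g with edge₁-ends g edge₁g | ends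
  ...   | u , _ , tg , _ | inj₁ (refl , _) = u , subst (Visits _ W _) tg (visits-tail W w g∈W)
  ...   | _ , u′ , _ , hg | inj₂ (_ , refl) = u′ , subst (Visits _ W _) hg (visits-head W w g∈W)

  walk-from-start : ∀ W → Walk start W finish → ∃₂ λ a b → ∃ λ W′ → W ≡ enter a b ∷ W′ × Walk (pt a b) W′ finish
  walk-from-start (enter a b ∷ W′) (refl , w′) = a , b , W′ , refl , w′
  walk-from-start (vert _ _ ∷ _)   (() , _)
  walk-from-start (horz _ _ ∷ _)   (() , _)
  walk-from-start (diag _ _ ∷ _)   (() , _)
  walk-from-start (exit _ _ ∷ _)   (() , _)

  module _ (en₁ : Ends G₁) (en₂ : Ends G₂) where

    Allowed : Edge → Set
    Allowed (enter a b) = sEdgeF G₁ G₂ en₁ en₂ a b ≡ true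
    Allowed (exit a b)  = tEdgeF G₁ G₂ en₁ en₂ a b ≡ true
    Allowed _           = ⊤

    record EulerAlignment (k : ℕ) : Set where
      field
        path      : List Edge
        walk      : Walk start path finish
        allowed   : All Allowed path
        covers₁   : trail₁ path ↭ allFin m₁
        covers₂   : trail₂ path ↭ allFin m₂
        path-cost : walk-cost path ≡ k

    inner-allowed : ∀ {a b c d} W → Walk (pt a b) W (pt c d) → All Allowed W
    inner-allowed []              refl             = []
    inner-allowed (vert _ _ ∷ W)  (refl , w)       = tt ∷ inner-allowed W w
    inner-allowed (horz _ _ ∷ W)  (refl , w)       = tt ∷ inner-allowed W w
    inner-allowed (diag _ _ ∷ W)  (refl , w)       = tt ∷ inner-allowed W w
    inner-allowed (enter _ _ ∷ _) (() , _)
    inner-allowed (exit _ _ ∷ []) (refl , ())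
    inner-allowed (exit _ _ ∷ g ∷ _) (refl , tg , _) = ⊥-elim (finish-has-no-out-edge g tg)

    close-alignment : ∀ {p₁ p₂ q₁ q₂} W → Walk (pt p₁ p₂) W (pt q₁ q₂) →
      sEdgeF G₁ G₂ en₁ en₂ p₁ p₂ ≡ true → tEdgeF G₁ G₂ en₁ en₂ q₁ q₂ ≡ true →
      trail₁ W ↭ allFin m₁ → trail₂ W ↭ allFin m₂ → EulerAlignment (walk-cost W)
    close-alignment {p₁} {p₂} {q₁} {q₂} W w s-edge t-edge W-covers₁ W-covers₂ = record
      { path      = enter p₁ p₂ ∷ W ++ exit q₁ q₂ ∷ []
      ; walk      = refl , walk-++ W w (refl , refl)
      ; allowed   = s-edge ∷ All-++⁺ (inner-allowed W w) (t-edge ∷ [])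
      ; covers₁   = ↭-trans (↭-reflexive (trans (mapMaybe-++ edge₁ W _) (++-identityʳ _))) W-covers₁
      ; covers₂   = ↭-trans (↭-reflexive (trans (mapMaybe-++ edge₂ W _) (++-identityʳ _))) W-covers₂
      ; path-cost = trans (sum-map-++ δ W _) (+-identityʳ _)
      }

  eulerAlignment⇒trails : ∀ {en₁ en₂ k} → EulerAlignment en₁ en₂ k →
    ∃₂ λ t₁ t₂ → EulerTrail G₁ t₁ × EulerTrail G₂ t₂ × edit _≟A_ (str G₁ t₁) (str G₂ t₂) ≤ k
  eulerAlignment⇒trails A with walk-from-start path walk
    where open EulerAlignment A
  ... | a , b , W , refl , w with project-walk W w
  ...   | c₁ , c₂ , w₁ , w₂ = trail₁ W , trail₂ W , (a , c₁ , w₁ , covers₁) , (b , c₂ , w₂ , covers₂) ,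
                              subst (_ ≤_) path-cost (edit-≤-walk-cost (enter a b ∷ W))
    where open EulerAlignment A

  trails⇒eulerAlignment : UEGraph G₁ → ∀ en₁ en₂ {t₁ t₂} → EulerTrail G₁ t₁ → EulerTrail G₂ t₂ →
    EulerAlignment en₁ en₂ (edit _≟A_ (str G₁ t₁) (str G₂ t₂))
  trails⇒eulerAlignment ue₁ en₁ en₂ {t₁} {t₂} (a₁ , b₁ , et₁) (a₂ , b₂ , et₂)
    with optimal-alignment t₁ t₂ (proj₁ et₁) (proj₁ et₂)
  ... | W , w , refl , refl , W-cost = subst (EulerAlignment en₁ en₂) W-cost (anchor en₁ en₂)
    where
    anchor : ∀ en₁ en₂ → EulerAlignment en₁ en₂ (walk-cost W)
    anchor (openE p₁ q₁ p₁≢q₁ (_ , et₁′)) (closedE _ _)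
      with Ends₁.open-euler-trail-ends p₁≢q₁ et₁′ et₁
    ... | refl , refl = close-alignment _ _ W w (is-refl p₁) (is-refl q₁) (proj₂ et₁) (proj₂ et₂)
    anchor (closedE _ _) (openE p₂ q₂ p₂≢q₂ (_ , et₂′))
      with Ends₂.open-euler-trail-ends p₂≢q₂ et₂′ et₂
    ... | refl , refl = close-alignment _ _ W w (is-refl p₂) (is-refl q₂) (proj₂ et₁) (proj₂ et₂)
    anchor (openE p₁ q₁ p₁≢q₁ (_ , et₁′)) (openE p₂ q₂ p₂≢q₂ (_ , et₂′))
      with Ends₁.open-euler-trail-ends p₁≢q₁ et₁′ et₁ | Ends₂.open-euler-trail-ends p₂≢q₂ et₂′ et₂
    ... | refl , refl | refl , refl = close-alignment _ _ W w
      (cong₂ _∧_ (is-refl p₁) (is-refl p₂)) (cong₂ _∧_ (is-refl q₁) (is-refl q₂)) (proj₂ et₁) (proj₂ et₂)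
    anchor (closedE c₁ (_ , _ , cl₁)) (closedE c₂ (_ , _ , cl₂))
      with Ends₁.closed-euler-trail-ends cl₁ et₁ | Ends₂.closed-euler-trail-ends cl₂ et₂
    ... | refl | refl with closed-walk-visits W w (proj₂ et₁) (proj₁ ue₁ c₁ a₁)
    -- rotate the closed walk W = W₁ ++ W₂ to W₂ ++ W₁, which starts and ends at (c₁, u)
    ...   | u , W₁ , W₂ , refl , w₁ , w₂ =
      subst (EulerAlignment _ _) (sum-map-↭ δ rotated)
        (close-alignment _ _ (W₂ ++ W₁) (walk-++ W₂ w₂ w₁)
          (cong (_∨ is u c₂) (is-refl c₁)) (cong (_∨ is u c₂) (is-refl c₁))
          (↭-trans (mapMaybe-↭ edge₁ rotated) (proj₂ et₁)) (↭-trans (mapMaybe-↭ edge₂ rotated) (proj₂ et₂)))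
      where
      rotated : W₂ ++ W₁ ↭ W₁ ++ W₂
      rotated = ++-comm W₂ W₁

-- The lower bound ILP

module LowerBoundILP {A : Set} (_≟A_ : DecidableEquality A) (G₁ G₂ : Graph A) (en₁ : Ends G₁) (en₂ : Ends G₂) where
  open Graph G₁ renaming (nV to n₁; nE to m₁; src to src₁; tgt to tgt₁; lab to lab₁)
  open Graph G₂ renaming (nV to n₂; nE to m₂; src to src₂; tgt to tgt₂; lab to lab₂)
  open Alignment _≟A_ G₁ G₂
  open Align _≟A_ G₁ G₂ en₁ en₂
  open Assign

  open BooleanEquality _==E_ ==E-reflects using ()
    renaming (multiplicity to occurrences-of; multiplicity-pos⇒∈ to occurrences-pos⇒∈; ∈⇒multiplicity-pos to ∈⇒occurrences-pos)

  mult : Assign → Edge → ℕ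
  mult x (vert e u)  = xv x e u
  mult x (horz u f)  = xh x u f
  mult x (diag e f)  = xd x e f
  mult x (enter a b) = xs x a b
  mult x (exit a b)  = xt x a b

  -- A sum over the edges of all five kinds, including the s- and t-edges that the construction leaves
  -- out (on which feasible solutions vanish).
  ΣE : (Edge → ℕ) → ℕ
  ΣE h = Σ² m₁ n₂ (λ e u → h (vert e u)) + (Σ² n₁ m₂ (λ u f → h (horz u f)) + (Σ² m₁ m₂ (λ e f → h (diag e f))
       + (Σ² n₁ n₂ (λ a b → h (enter a b)) + Σ² n₁ n₂ (λ a b → h (exit a b)))))

  weight : Assign → (Edge → ℕ) → ℕ
  weight x h = ΣE (λ g → mult x g * h g)

  ΣE-cong : ∀ {h k} → (∀ g → h g ≡ k g) → ΣE h ≡ ΣE k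
  ΣE-cong h≡k =
    cong₂ _+_ (Σ²-cong m₁ n₂ λ e u → h≡k (vert e u)) (cong₂ _+_ (Σ²-cong n₁ m₂ λ u f → h≡k (horz u f))
    (cong₂ _+_ (Σ²-cong m₁ m₂ λ e f → h≡k (diag e f)) (cong₂ _+_ (Σ²-cong n₁ n₂ λ a b → h≡k (enter a b))
    (Σ²-cong n₁ n₂ λ a b → h≡k (exit a b)))))

  ΣE-zero : ∀ {h} → (∀ g → h g ≡ 0) → ΣE h ≡ 0
  ΣE-zero h≡0 =
    cong₂ _+_ (Σ²-zero m₁ n₂ λ e u → h≡0 (vert e u)) (cong₂ _+_ (Σ²-zero n₁ m₂ λ u f → h≡0 (horz u f))
    (cong₂ _+_ (Σ²-zero m₁ m₂ λ e f → h≡0 (diag e f)) (cong₂ _+_ (Σ²-zero n₁ n₂ λ a b → h≡0 (enter a b))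
    (Σ²-zero n₁ n₂ λ a b → h≡0 (exit a b)))))

  ΣE-+ : ∀ (h k : Edge → ℕ) → ΣE (λ g → h g + k g) ≡ ΣE h + ΣE k
  ΣE-+ h k = begin
    ΣE (λ g → h g + k g)
      ≡⟨ cong₂ _+_ (Σ²-+ m₁ n₂ (λ e u → h (vert e u)) (λ e u → k (vert e u)))
          (cong₂ _+_ (Σ²-+ n₁ m₂ (λ u f → h (horz u f)) (λ u f → k (horz u f)))
          (cong₂ _+_ (Σ²-+ m₁ m₂ (λ e f → h (diag e f)) (λ e f → k (diag e f)))
          (cong₂ _+_ (Σ²-+ n₁ n₂ (λ a b → h (enter a b)) (λ a b → k (enter a b)))
                     (Σ²-+ n₁ n₂ (λ a b → h (exit a b)) (λ a b → k (exit a b)))))) ⟩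
    (V h + V k) + ((H h + H k) + ((D h + D k) + ((S h + S k) + (T h + T k))))
      ≡⟨ cong (λ z → (V h + V k) + ((H h + H k) + ((D h + D k) + z))) (interchange (S h) (S k) (T h) (T k)) ⟩
    (V h + V k) + ((H h + H k) + ((D h + D k) + ((S h + T h) + (S k + T k))))
      ≡⟨ cong (λ z → (V h + V k) + ((H h + H k) + z)) (interchange (D h) (D k) (S h + T h) (S k + T k)) ⟩
    (V h + V k) + ((H h + H k) + ((D h + (S h + T h)) + (D k + (S k + T k))))
      ≡⟨ cong ((V h + V k) +_) (interchange (H h) (H k) (D h + (S h + T h)) (D k + (S k + T k))) ⟩
    (V h + V k) + ((H h + (D h + (S h + T h))) + (H k + (D k + (S k + T k))))
      ≡⟨ interchange (V h) (V k) (H h + (D h + (S h + T h))) (H k + (D k + (S k + T k))) ⟩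
    ΣE h + ΣE k ∎
    where
    open ≡-Reasoning
    V H D S T : (Edge → ℕ) → ℕ
    V f = Σ² m₁ n₂ (λ e u → f (vert e u))
    H f = Σ² n₁ m₂ (λ u g → f (horz u g))
    D f = Σ² m₁ m₂ (λ e g → f (diag e g))
    S f = Σ² n₁ n₂ (λ a b → f (enter a b))
    T f = Σ² n₁ n₂ (λ a b → f (exit a b))

  ΣE-sum-swap : ∀ {B : Set} (k : Edge → B → ℕ) L → ΣE (λ g → sum (map (k g) L)) ≡ sum (map (λ b → ΣE (λ g → k g b)) L)
  ΣE-sum-swap k []      = ΣE-zero (λ _ → refl)
  ΣE-sum-swap k (b ∷ L) =
    trans (ΣE-+ (λ g → k g b) (λ g → sum (map (k g) L))) (cong (ΣE (λ g → k g b) +_) (ΣE-sum-swap k L))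

  ΣE-point : ∀ b (h : Edge → ℕ) → ΣE (λ g → 𝟙 (b ==E g) * h g) ≡ h b
  ΣE-point (vert e u) h =
    trans (cong₂ _+_ (Σ²-point m₁ n₂ (λ i j → h (vert i j)) e u)
                     (cong₂ _+_ (Σ²-0 n₁ m₂) (cong₂ _+_ (Σ²-0 m₁ m₂) (cong₂ _+_ (Σ²-0 n₁ n₂) (Σ²-0 n₁ n₂)))))
          (+-identityʳ _)
  ΣE-point (horz u f) h = cong₂ _+_ (Σ²-0 m₁ n₂)
    (trans (cong₂ _+_ (Σ²-point n₁ m₂ (λ i j → h (horz i j)) u f)
                      (cong₂ _+_ (Σ²-0 m₁ m₂) (cong₂ _+_ (Σ²-0 n₁ n₂) (Σ²-0 n₁ n₂))))
           (+-identityʳ _))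
  ΣE-point (diag e f) h = cong₂ _+_ (Σ²-0 m₁ n₂) (cong₂ _+_ (Σ²-0 n₁ m₂)
    (trans (cong₂ _+_ (Σ²-point m₁ m₂ (λ i j → h (diag i j)) e f) (cong₂ _+_ (Σ²-0 n₁ n₂) (Σ²-0 n₁ n₂)))
           (+-identityʳ _)))
  ΣE-point (enter a b) h = cong₂ _+_ (Σ²-0 m₁ n₂) (cong₂ _+_ (Σ²-0 n₁ m₂) (cong₂ _+_ (Σ²-0 m₁ m₂)
    (trans (cong₂ _+_ (Σ²-point n₁ n₂ (λ i j → h (enter i j)) a b) (Σ²-0 n₁ n₂)) (+-identityʳ _))))
  ΣE-point (exit a b) h = cong₂ _+_ (Σ²-0 m₁ n₂) (cong₂ _+_ (Σ²-0 n₁ m₂) (cong₂ _+_ (Σ²-0 m₁ m₂)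
    (cong₂ _+_ (Σ²-0 n₁ n₂) (Σ²-point n₁ n₂ (λ i j → h (exit i j)) a b))))

  occurrences : List Edge → Assign
  occurrences W = record
    { xv = λ e u → occurrences-of (vert e u) W
    ; xh = λ u f → occurrences-of (horz u f) W
    ; xd = λ e f → occurrences-of (diag e f) W
    ; xs = λ a b → occurrences-of (enter a b) W
    ; xt = λ a b → occurrences-of (exit a b) W
    }

  mult-occurrences : ∀ W g → mult (occurrences W) g ≡ occurrences-of g W
  mult-occurrences W (vert _ _)  = refl
  mult-occurrences W (horz _ _)  = refl
  mult-occurrences W (diag _ _)  = refl
  mult-occurrences W (enter _ _) = refl
  mult-occurrences W (exit _ _)  = refl

  weight-occurrences : ∀ W (h : Edge → ℕ) → weight (occurrences W) h ≡ sum (map h W)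
  weight-occurrences W h = begin
    weight (occurrences W) h                               ≡⟨ ΣE-cong (λ g → cong (_* h g) (mult-occurrences W g)) ⟩
    ΣE (λ g → occurrences-of g W * h g)                    ≡⟨ ΣE-cong (λ g → sum-map-*ʳ (λ b → 𝟙 (b ==E g)) (h g) W) ⟩
    ΣE (λ g → sum (map (λ b → 𝟙 (b ==E g) * h g) W))      ≡⟨ ΣE-sum-swap (λ g b → 𝟙 (b ==E g) * h g) W ⟩
    sum (map (λ b → ΣE (λ g → 𝟙 (b ==E g) * h g)) W)      ≡⟨ sum-map-cong (λ b → ΣE-point b h) W ⟩
    sum (map h W)                                          ∎
    where open ≡-Reasoning

  copies : Assign → ∀ n m → (Fin n → Fin m → Edge) → List Edge
  copies x n m c = replicas n m (λ i j → mult x (c i j)) c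

  edges : Assign → List Edge
  edges x = copies x m₁ n₂ vert ++ (copies x n₁ m₂ horz ++ (copies x m₁ m₂ diag
          ++ (copies x n₁ n₂ enter ++ copies x n₁ n₂ exit)))

  sum-map-edges : ∀ x (h : Edge → ℕ) → sum (map h (edges x)) ≡ weight x h
  sum-map-edges x h =
    trans (sum-map-++ h (copies x m₁ n₂ vert) _) (cong₂ _+_ (sum-map-replicas m₁ n₂ (xv x) vert h)
    (trans (sum-map-++ h (copies x n₁ m₂ horz) _) (cong₂ _+_ (sum-map-replicas n₁ m₂ (xh x) horz h)
    (trans (sum-map-++ h (copies x m₁ m₂ diag) _) (cong₂ _+_ (sum-map-replicas m₁ m₂ (xd x) diag h)
    (trans (sum-map-++ h (copies x n₁ n₂ enter) _) (cong₂ _+_ (sum-map-replicas n₁ n₂ (xs x) enter h)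
    (sum-map-replicas n₁ n₂ (xt x) exit h))))))))

  weight-zero : ∀ x {h : Edge → ℕ} → (∀ g → h g ≡ 0) → weight x h ≡ 0
  weight-zero x h≡0 = ΣE-zero (λ g → trans (cong (mult x g *_) (h≡0 g)) (*-zeroʳ (mult x g)))

  cost≡weight : ∀ x → cost x ≡ weight x δ
  cost≡weight x = sym (begin
    weight x δ
      ≡⟨ cong₂ _+_ (Σ²-*1 m₁ n₂ (xv x)) (cong₂ _+_ (Σ²-*1 n₁ m₂ (xh x))
           (cong (C +_) (cong₂ _+_ (Σ²-*0 n₁ n₂ (xs x)) (Σ²-*0 n₁ n₂ (xt x))))) ⟩
    V + (H + (C + 0)) ≡⟨ cong (λ z → V + (H + z)) (+-identityʳ C) ⟩
    V + (H + C)       ≡⟨ sym (+-assoc V H C) ⟩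
    V + H + C         ∎)
    where
    open ≡-Reasoning
    V H C : ℕ
    V = Σ² m₁ n₂ (xv x)
    H = Σ² n₁ m₂ (xh x)
    C = Σ² m₁ m₂ (λ e f → xd x e f * δd e f)

  inner-flow : ∀ x (τ₁ : Fin m₁ → Fin n₁) (τ₂ : Fin m₂ → Fin n₂) v₁ v₂ {r r′ : ℕ} → r ≡ r′ →
      Σ² m₁ n₂ (λ e u → xv x e u * 𝟙 (is (τ₁ e) v₁ ∧ is u v₂))
    + (Σ² n₁ m₂ (λ u f → xh x u f * 𝟙 (is u v₁ ∧ is (τ₂ f) v₂))
    + (Σ² m₁ m₂ (λ e f → xd x e f * 𝟙 (is (τ₁ e) v₁ ∧ is (τ₂ f) v₂)) + r))
    ≡ sumF m₁ (λ e → if is (τ₁ e) v₁ then xv x e v₂ else 0)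
    + sumF m₂ (λ f → if is (τ₂ f) v₂ then xh x v₁ f else 0)
    + sumF m₁ (λ e → sumF m₂ (λ f → if is (τ₁ e) v₁ ∧ is (τ₂ f) v₂ then xd x e f else 0))
    + r′
  inner-flow x τ₁ τ₂ v₁ v₂ r≡r′ =
    trans (cong₂ _+_ (Σ²-fix₂ m₁ n₂ (xv x) (λ e → is (τ₁ e) v₁) v₂)
          (cong₂ _+_ (Σ²-fix₁ n₁ m₂ (xh x) v₁ (λ f → is (τ₂ f) v₂))
          (cong₂ _+_ (Σ²-cong m₁ m₂ (λ e f → *-𝟙 (xd x e f) (is (τ₁ e) v₁ ∧ is (τ₂ f) v₂))) r≡r′)))
          (+-reassoc (sumF m₁ (λ e → if is (τ₁ e) v₁ then xv x e v₂ else 0))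
                     (sumF m₂ (λ f → if is (τ₂ f) v₂ then xh x v₁ f else 0))
                     (sumF m₁ (λ e → sumF m₂ (λ f → if is (τ₁ e) v₁ ∧ is (τ₂ f) v₂ then xd x e f else 0))) _)

  outflow≡weight : ∀ x v₁ v₂ → outflow x v₁ v₂ ≡ weight x (λ g → 𝟙 (tail g == pt v₁ v₂))
  outflow≡weight x v₁ v₂ =
    sym (inner-flow x src₁ src₂ v₁ v₂ (cong₂ _+_ (Σ²-*0 n₁ n₂ (xs x)) (Σ²-select n₁ n₂ (xt x) v₁ v₂)))

  inflow≡weight : ∀ x v₁ v₂ → inflow x v₁ v₂ ≡ weight x (λ g → 𝟙 (head g == pt v₁ v₂))
  inflow≡weight x v₁ v₂ = sym (inner-flow x tgt₁ tgt₂ v₁ v₂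
    (trans (cong₂ _+_ (Σ²-select n₁ n₂ (xs x) v₁ v₂) (Σ²-*0 n₁ n₂ (xt x))) (+-identityʳ (xs x v₁ v₂))))

  cover₁≡weight : ∀ x f → sumF n₂ (xv x f) + sumF m₂ (xd x f) ≡ weight x (I₁ f)
  cover₁≡weight x f = sym (trans
    (cong₂ _+_ (Σ²-fix₁′ m₁ n₂ (xv x) f) (cong₂ _+_ (Σ²-*0 n₁ m₂ (xh x))
      (cong₂ _+_ (Σ²-fix₁′ m₁ m₂ (xd x) f) (cong₂ _+_ (Σ²-*0 n₁ n₂ (xs x)) (Σ²-*0 n₁ n₂ (xt x))))))
    (cong (sumF n₂ (xv x f) +_) (+-identityʳ _)))

  cover₂≡weight : ∀ x f → sumF n₁ (λ u → xh x u f) + sumF m₁ (λ e → xd x e f) ≡ weight x (I₂ f)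
  cover₂≡weight x f = sym (trans
    (cong₂ _+_ (Σ²-*0 m₁ n₂ (xv x)) (cong₂ _+_ (Σ²-fix₂′ n₁ m₂ (xh x) f)
      (cong₂ _+_ (Σ²-fix₂′ m₁ m₂ (xd x) f) (cong₂ _+_ (Σ²-*0 n₁ n₂ (xs x)) (Σ²-*0 n₁ n₂ (xt x))))))
    (cong (sumF n₁ (λ u → xh x u f) +_) (+-identityʳ _)))

  source≡weight : ∀ x → Σ² n₁ n₂ (xs x) ≡ weight x (λ g → 𝟙 (tail g == start))
  source≡weight x = sym (trans
    (cong₂ _+_ (Σ²-*0 m₁ n₂ (xv x)) (cong₂ _+_ (Σ²-*0 n₁ m₂ (xh x))
      (cong₂ _+_ (Σ²-*0 m₁ m₂ (xd x)) (cong₂ _+_ (Σ²-*1 n₁ n₂ (xs x)) (Σ²-*0 n₁ n₂ (xt x))))))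
    (+-identityʳ _))

  sink≡weight : ∀ x → Σ² n₁ n₂ (xt x) ≡ weight x (λ g → 𝟙 (head g == finish))
  sink≡weight x = sym
    (cong₂ _+_ (Σ²-*0 m₁ n₂ (xv x)) (cong₂ _+_ (Σ²-*0 n₁ m₂ (xh x))
      (cong₂ _+_ (Σ²-*0 m₁ m₂ (xd x)) (cong₂ _+_ (Σ²-*0 n₁ n₂ (xs x)) (Σ²-*1 n₁ n₂ (xt x))))))

  toNode : ∀ {x} → Vertex → Node x
  toNode start    = s
  toNode finish   = t
  toNode (pt a b) = node a b

  fromNode : ∀ {x} → Node x → Vertex
  fromNode s          = start
  fromNode t          = finish
  fromNode (node a b) = pt a b

  fromNode-toNode : ∀ {x} v → fromNode {x} (toNode v) ≡ v
  fromNode-toNode start    = refl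
  fromNode-toNode finish   = refl
  fromNode-toNode (pt _ _) = refl

  supp-edge⁺ : ∀ x g → Allowed en₁ en₂ g → 1 ≤ mult x g → SuppEdge x (toNode (tail g)) (toNode (head g))
  supp-edge⁺ x (vert e u)  _       pos = vertE e u pos
  supp-edge⁺ x (horz u f)  _       pos = horE u f pos
  supp-edge⁺ x (diag e f)  _       pos = diagE e f pos
  supp-edge⁺ x (enter a b) allowed pos = sE a b allowed pos
  supp-edge⁺ x (exit a b)  allowed pos = tE a b allowed pos

  supp-edge⁻ : ∀ {x a b} → SuppEdge x a b → ∃ λ g → 1 ≤ mult x g × a ≡ toNode (tail g) × b ≡ toNode (head g)
  supp-edge⁻ (vertE e u pos)  = vert e u , pos , refl , refl
  supp-edge⁻ (horE u f pos)   = horz u f , pos , refl , refl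
  supp-edge⁻ (diagE e f pos)  = diag e f , pos , refl , refl
  supp-edge⁻ (sE a b _ pos)   = enter a b , pos , refl , refl
  supp-edge⁻ (tE a b _ pos)   = exit a b , pos , refl , refl

  feasible-allowed : ∀ {x} → Feasible x → ∀ g → 1 ≤ mult x g → Allowed en₁ en₂ g
  feasible-allowed feas (vert _ _) _ = tt
  feasible-allowed feas (horz _ _) _ = tt
  feasible-allowed feas (diag _ _) _ = tt
  feasible-allowed feas (enter a b) pos with sEdge a b in absent
  ... | true  = refl
  ... | false = ⊥-elim (n≮0 (subst (1 ≤_) (Feasible.s-absent feas a b absent) pos))
  feasible-allowed feas (exit a b) pos with tEdge a b in absent
  ... | true  = refl
  ... | false = ⊥-elim (n≮0 (subst (1 ≤_) (Feasible.t-absent feas a b absent) pos))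

  ∈-edges⁻ : ∀ x {g} → g ∈ edges x → 1 ≤ mult x g
  ∈-edges⁻ x g∈ with ∈-++⁻ (copies x m₁ n₂ vert) g∈
  ... | inj₁ g∈V = ∈-replicas-pos m₁ n₂ (mult x) vert g∈V
  ... | inj₂ g∈₁ with ∈-++⁻ (copies x n₁ m₂ horz) g∈₁
  ...   | inj₁ g∈H = ∈-replicas-pos n₁ m₂ (mult x) horz g∈H
  ...   | inj₂ g∈₂ with ∈-++⁻ (copies x m₁ m₂ diag) g∈₂
  ...     | inj₁ g∈D = ∈-replicas-pos m₁ m₂ (mult x) diag g∈D
  ...     | inj₂ g∈₃ with ∈-++⁻ (copies x n₁ n₂ enter) g∈₃
  ...       | inj₁ g∈S = ∈-replicas-pos n₁ n₂ (mult x) enter g∈S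
  ...       | inj₂ g∈T = ∈-replicas-pos n₁ n₂ (mult x) exit g∈T

  ∈-edges⁺ : ∀ x g → 1 ≤ mult x g → g ∈ edges x
  ∈-edges⁺ x (vert e u) pos = ∈-++⁺ˡ (∈-replicas⁺ m₁ n₂ (xv x) vert e u pos)
  ∈-edges⁺ x (horz u f) pos =
    ∈-++⁺ʳ (copies x m₁ n₂ vert) (∈-++⁺ˡ (∈-replicas⁺ n₁ m₂ (xh x) horz u f pos))
  ∈-edges⁺ x (diag e f) pos =
    ∈-++⁺ʳ (copies x m₁ n₂ vert) (∈-++⁺ʳ (copies x n₁ m₂ horz) (∈-++⁺ˡ (∈-replicas⁺ m₁ m₂ (xd x) diag e f pos)))
  ∈-edges⁺ x (enter a b) pos =
    ∈-++⁺ʳ (copies x m₁ n₂ vert) (∈-++⁺ʳ (copies x n₁ m₂ horz) (∈-++⁺ʳ (copies x m₁ m₂ diag)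
      (∈-++⁺ˡ (∈-replicas⁺ n₁ n₂ (xs x) enter a b pos))))
  ∈-edges⁺ x (exit a b) pos =
    ∈-++⁺ʳ (copies x m₁ n₂ vert) (∈-++⁺ʳ (copies x n₁ m₂ horz) (∈-++⁺ʳ (copies x m₁ m₂ diag)
      (∈-++⁺ʳ (copies x n₁ n₂ enter) (∈-replicas⁺ n₁ n₂ (xt x) exit a b pos))))

  head≢start : ∀ g → 𝟙 (head g == start) ≡ 0
  head≢start (vert _ _)  = refl
  head≢start (horz _ _)  = refl
  head≢start (diag _ _)  = refl
  head≢start (enter _ _) = refl
  head≢start (exit _ _)  = refl

  tail≢finish : ∀ g → 𝟙 (tail g == finish) ≡ 0
  tail≢finish (vert _ _)  = refl
  tail≢finish (horz _ _)  = refl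
  tail≢finish (diag _ _)  = refl
  tail≢finish (enter _ _) = refl
  tail≢finish (exit _ _)  = refl

  feasible⇒degrees : ∀ {x} → Feasible x → TrailDegrees (edges x) start finish
  feasible⇒degrees {x} feas start = trans (cong (_+ 0) (begin
    outdeg start (edges x)                    ≡⟨ sum-map-edges x _ ⟩
    weight x (λ g → 𝟙 (tail g == start))      ≡⟨ sym (source≡weight x) ⟩
    Σ² n₁ n₂ (xs x)                           ≡⟨ Feasible.source feas ⟩
    1                                         ∎)) (cong (_+ 1) (sym (trans (sum-map-edges x _) (weight-zero x head≢start))))
    where open ≡-Reasoning
  feasible⇒degrees {x} feas finish = trans (cong (_+ 1) (trans (sum-map-edges x _) (weight-zero x tail≢finish))) (cong (_+ 0) (begin
    1                                         ≡⟨ sym (Feasible.sink feas) ⟩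
    Σ² n₁ n₂ (xt x)                           ≡⟨ sink≡weight x ⟩
    weight x (λ g → 𝟙 (head g == finish))     ≡⟨ sym (sum-map-edges x _) ⟩
    indeg finish (edges x)                    ∎))
    where open ≡-Reasoning
  feasible⇒degrees {x} feas (pt v₁ v₂) = cong (_+ 0) (begin
    outdeg (pt v₁ v₂) (edges x)               ≡⟨ sum-map-edges x _ ⟩
    weight x (λ g → 𝟙 (tail g == pt v₁ v₂))   ≡⟨ sym (outflow≡weight x v₁ v₂) ⟩
    outflow x v₁ v₂                           ≡⟨ sym (Feasible.conserve feas v₁ v₂) ⟩
    inflow x v₁ v₂                            ≡⟨ inflow≡weight x v₁ v₂ ⟩
    weight x (λ g → 𝟙 (head g == pt v₁ v₂))   ≡⟨ sym (sum-map-edges x _) ⟩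
    indeg (pt v₁ v₂) (edges x)                ∎)
    where open ≡-Reasoning

  feasible⇒connected : ∀ {x} → Feasible x → OneComponent x → ConnectedFrom (edges x) start
  feasible⇒connected {x} feas (_ , connected) g g∈ =
    subst (Star (Adjacent (edges x)) start) (fromNode-toNode (tail g))
      (gmap fromNode adjacent (connected s (toNode (tail g)) s-in-support tail-in-support))
    where
    pos : 1 ≤ mult x g
    pos = ∈-edges⁻ x g∈

    tail-in-support : InSupp x (toNode (tail g))
    tail-in-support = toNode (head g) , inj₁ (supp-edge⁺ x g (feasible-allowed feas g pos) pos)

    s-in-support : InSupp x s
    s-in-support with sumF-pos n₁ _ (≤-reflexive (sym (Feasible.source feas)))
    ... | a , pos-a with sumF-pos n₂ _ pos-a
    ...   | b , pos-b = toNode (pt a b) , inj₁ (supp-edge⁺ x (enter a b) (feasible-allowed feas (enter a b) pos-b) pos-b)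

    adjacent : ∀ {a b} → SuppAdj x a b → Adjacent (edges x) (fromNode a) (fromNode b)
    adjacent (inj₁ e) with supp-edge⁻ e
    ... | g , pos , refl , refl = g , ∈-edges⁺ x g pos , inj₁ (sym (fromNode-toNode (tail g)) , sym (fromNode-toNode (head g)))
    adjacent (inj₂ e) with supp-edge⁻ e
    ... | g , pos , refl , refl = g , ∈-edges⁺ x g pos , inj₂ (sym (fromNode-toNode (tail g)) , sym (fromNode-toNode (head g)))

  solution⇒eulerAlignment : ∀ {x} → Feasible x → OneComponent x → EulerAlignment en₁ en₂ (cost x)
  solution⇒eulerAlignment {x} feas oc
    with euler-trail (edges x) start finish (feasible⇒degrees feas) (feasible⇒connected feas oc)
  ... | W , w , W↭ = record
    { path      = W
    ; walk      = w
    ; allowed   = All.tabulate (λ {g} g∈ → feasible-allowed feas g (∈-edges⁻ x (∈-resp-↭ W↭ g∈)))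
    ; covers₁   = Equivalence.from (covers-once₁ W) (λ f →
                    trans (sum-map-↭ (I₁ f) W↭) (trans (sum-map-edges x (I₁ f))
                          (trans (sym (cover₁≡weight x f)) (Feasible.cover₁ feas f))))
    ; covers₂   = Equivalence.from (covers-once₂ W) (λ f →
                    trans (sum-map-↭ (I₂ f) W↭) (trans (sum-map-edges x (I₂ f))
                          (trans (sym (cover₂≡weight x f)) (Feasible.cover₂ feas f))))
    ; path-cost = trans (sum-map-↭ δ W↭) (trans (sum-map-edges x δ) (sym (cost≡weight x)))
    }

  occurrences-absent : ∀ {W} → All (Allowed en₁ en₂) W → ∀ g → ¬ Allowed en₁ en₂ g → mult (occurrences W) g ≡ 0
  occurrences-absent {W} allowed g ¬allowed with mult (occurrences W) g in eq
  ... | zero  = refl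
  ... | suc _ = ⊥-elim (¬allowed (All.lookup allowed (occurrences-pos⇒∈ g W
                  (subst (1 ≤_) (trans (sym eq) (mult-occurrences W g)) (s≤s z≤n)))))

  occurrences-feasible : ∀ {k} (A : EulerAlignment en₁ en₂ k) → Feasible (occurrences (EulerAlignment.path A))
  occurrences-feasible A = record
    { s-absent = λ a b false → occurrences-absent allowed (enter a b) (λ true → contradiction (trans (sym true) false) λ ())
    ; t-absent = λ a b false → occurrences-absent allowed (exit a b) (λ true → contradiction (trans (sym true) false) λ ())
    ; cover₁   = λ f → trans (cover₁≡weight x f) (trans (weight-path (I₁ f)) (Equivalence.to (covers-once₁ path) covers₁ f))
    ; cover₂   = λ f → trans (cover₂≡weight x f) (trans (weight-path (I₂ f)) (Equivalence.to (covers-once₂ path) covers₂ f))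
    ; source   = trans (source≡weight x) (trans (weight-path _) (trans (sym (+-identityʳ _))
                   (trans (degrees start) (cong (_+ 1) (sum-map-zero head≢start path)))))
    ; sink     = trans (sink≡weight x) (trans (weight-path _) (trans (sym (+-identityʳ _))
                   (trans (sym (degrees finish)) (cong (_+ 1) (sum-map-zero tail≢finish path)))))
    ; conserve = λ v₁ v₂ → trans (inflow≡weight x v₁ v₂) (trans (weight-path _)
                   (trans (sym (+-cancelʳ-≡ 0 _ _ (degrees (pt v₁ v₂))))
                     (trans (sym (weight-path _)) (sym (outflow≡weight x v₁ v₂)))))
    }
    where
    open EulerAlignment A

    x : Assign
    x = occurrences path

    weight-path : ∀ h → weight x h ≡ sum (map h path)
    weight-path = weight-occurrences path

    degrees : TrailDegrees path start finish
    degrees = walk-degrees path walk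

  occurrences-oneComponent : ∀ W → Walk start W finish → All (Allowed en₁ en₂) W → OneComponent (occurrences W)
  occurrences-oneComponent W w allowed = (s , s-in-support) , λ a b a∈ b∈ → Star.reverse Sum.swap (reachable a∈) ◅◅ reachable b∈
    where
    x : Assign
    x = occurrences W

    support-edge : ∀ {g} → g ∈ W → SuppEdge x (toNode (tail g)) (toNode (head g))
    support-edge {g} g∈ = supp-edge⁺ x g (All.lookup allowed g∈)
      (subst (1 ≤_) (sym (mult-occurrences W g)) (∈⇒occurrences-pos g∈))

    on-walk : ∀ g → 1 ≤ mult x g → g ∈ W
    on-walk g pos = occurrences-pos⇒∈ g W (subst (1 ≤_) (mult-occurrences W g) pos)

    reachable : ∀ {a} → InSupp x a → Star (SuppAdj x) s a
    reachable (_ , inj₁ e) with supp-edge⁻ e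
    ... | g , pos , refl , refl = gmap toNode inj₁ (proj₁ (walk-reaches W w support-edge (on-walk g pos)))
    reachable (_ , inj₂ e) with supp-edge⁻ e
    ... | g , pos , refl , refl = gmap toNode inj₁ (proj₂ (walk-reaches W w support-edge (on-walk g pos)))

    s-in-support : InSupp x s
    s-in-support with walk-from-start W w
    ... | a , b , _ , refl , _ = node a b , inj₁ (support-edge (here refl))

  ConnectedSolution : ℕ → Set
  ConnectedSolution k = ∃ λ x → Feasible x × cost x ≡ k × OneComponent x

  eulerAlignment⇒solution : ∀ {k} → EulerAlignment en₁ en₂ k → ConnectedSolution k
  eulerAlignment⇒solution A =
    occurrences path , occurrences-feasible A ,
    trans (cost≡weight (occurrences path)) (trans (weight-occurrences path δ) path-cost) ,
    occurrences-oneComponent path walk allowed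
    where open EulerAlignment A

  gted-≤-connected : ∀ {d k} → IsGTED _≟A_ G₁ G₂ d → ConnectedSolution k → d ≤ k
  gted-≤-connected (_ , d-minimal) (x , feasible , x-cost , connected) =
    let t₁ , t₂ , et₁ , et₂ , edit≤cost = eulerAlignment⇒trails (solution⇒eulerAlignment feasible connected)
    in ≤-trans (d-minimal t₁ t₂ et₁ et₂) (≤-trans edit≤cost (≤-reflexive x-cost))

  gted-connected : UEGraph G₁ → ∀ {d} → IsGTED _≟A_ G₁ G₂ d → ConnectedSolution d
  gted-connected ue₁ ((t₁ , t₂ , et₁ , et₂ , t-cost) , _) =
    eulerAlignment⇒solution (subst (EulerAlignment en₁ en₂) t-cost (trails⇒eulerAlignment ue₁ en₁ en₂ et₁ et₂))

theorem5 : {A : Set} (_≟A_ : DecidableEquality A) (G₁ G₂ : Graph A)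
    → UEGraph G₁ → UEGraph G₂
    → (en₁ : Ends G₁) (en₂ : Ends G₂)
    → (c : ℕ) → Align.IsOptValue _≟A_ G₁ G₂ en₁ en₂ c
    → (d : ℕ) → IsGTED _≟A_ G₁ G₂ d
    → (∃ λ x → Align.Feasible _≟A_ G₁ G₂ en₁ en₂ x
               × Align.cost _≟A_ G₁ G₂ en₁ en₂ x ≡ c
               × Align.OneComponent _≟A_ G₁ G₂ en₁ en₂ x)
      ⇔ (c ≡ d)
-- Only G₁ needs to be connected: it is where closed alignments are rotated.
theorem5 _≟A_ G₁ G₂ ue₁ _ en₁ en₂ c (_ , c-minimal) d gted =
  mk⇔ (λ c-solution → ≤-antisym c≤d (gted-≤-connected gted c-solution))
      (λ c≡d → subst ConnectedSolution (sym c≡d) d-solution)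
  where
  open LowerBoundILP _≟A_ G₁ G₂ en₁ en₂
  d-solution : ConnectedSolution d
  d-solution = gted-connected ue₁ gted

  c≤d : c ≤ d
  c≤d = let y , y-feasible , y-cost , _ = d-solution in ≤-trans (c-minimal y y-feasible) (≤-reflexive y-cost)
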